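{- Let $\alpha$ be generic, $T\in\{\mathrm{AS},\mathrm{AA},\mathrm{SA},\mathrm{SS}\}$, and let $\Lambda=(\Lambda_1,\dots,\Lambda_m;\Lambda_{m+1},\dots,\Lambda_N)$ be a superpartition in the index set of type $T$. Let $\Lambda_+=(\Lambda_1+1,\dots,\Lambda_m+1;\Lambda_{m+1}+1,\dots,\Lambda_N+1)$. Then $x_1\cdots x_N\,P^T_\Lambda(x;\alpha)=P^T_{\Lambda_+}(x;\alpha)$.
   Context: Fix $N\ge1$, $0\le m\le N$; $I=\{1,\dots,m\}$, $J=\{m+1,\dots,N\}$. $K_{i,j}$ exchanges $x_i,x_j$. For $K\subseteq\{1,\dots,N\}$, $S_K$ = permutations fixing every element outside $K$; $\mathrm{Asym}_Kf=\sum_{\sigma\in S_K}\mathrm{sgn}(\sigma)f(x_{\sigma(1)},\dots,x_{\sigma(N)})$, $\mathrm{Sym}_Kf=\sum_{\sigma\in S_K}f(x_{\sigma(1)},\dots,x_{\sigma(N)})$. Compositions $\eta\in\mathbb{Z}_{\ge0}^N$, $\eta^+$ decreasing rearrangement; $\eta\succ\nu$ iff $\eta\ne\nu$, same degree, and $\eta^+>\nu^+$ in dominance, or $\eta^+=\nu^+$ and $\sum_{i\le k}\eta_i\ge\sum_{i\le k}\nu_i$ for all $k$. Cherednik operators $\xi_j=\alpha x_j\partial_{x_j}+\sum_{i<j}\frac{x_j}{x_j-x_i}(1-K_{i,j})+\sum_{i>j}\frac{x_i}{x_j-x_i}(1-K_{i,j})-(j-1)$. $\alpha$ generic: formal parameter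 or complex number neither $0$ nor negative rational; then $E_\eta(x;\alpha)$ is the unique polynomial $x^\eta+\sum_{\nu\prec\eta}c_{\eta,\nu}x^\nu$ with $\xi_jE_\eta=\bar\eta_jE_\eta$, $\bar\eta_j=\alpha\eta_j-\#\{i<j:\eta_i\ge\eta_j\}-\#\{i>j:\eta_i>\eta_j\}$. Superpartition: $\Lambda=(\Lambda_1,\dots,\Lambda_m;\Lambda_{m+1},\dots,\Lambda_N)$, nonnegative, $\Lambda_1\ge\dots\ge\Lambda_m$, $\Lambda_{m+1}\ge\dots\ge\Lambda_N$; strict if $\Lambda_1>\dots>\Lambda_m$. With $\eta_\Lambda=(\Lambda_m,\dots,\Lambda_1,\Lambda_N,\dots,\Lambda_{m+1})$: $P^{AS}_\Lambda=c\,\mathrm{Asym}_I\mathrm{Sym}_JE_{\eta_\Lambda}$, $P^{AA}_\Lambda=c\,\mathrm{Asym}_I\mathrm{Asym}_JE_{\eta_\Lambda}$, $P^{SA}_\Lambda=c\,\mathrm{Sym}_I\mathrm{Asym}_JE_{\eta_\Lambda}$, $P^{SS}_\Lambda=c\,\mathrm{Sym}_I\mathrm{Sym}_JE_{\eta_\Lambda}$, with $c$ making the coefficient of $x_1^{\Lambda_1}\cdots x_N^{\Lambda_N}$ equal to $1$. Index sets: AS strict; AA strict with $\Lambda_{m+1}>\dots>\Lambda_N$; SA $\Lambda_{m+1}>\dots>\Lambda_N$; SS all. -}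

module Defs where

open import Level using (Level; _⊔_)
open import Algebra.Bundles using (CommutativeRing)
open import Data.Nat as ℕ using (ℕ; zero; suc; _∸_)
open import Data.Bool using (Bool; true; false; _∧_; _∨_; not; if_then_else_)
open import Data.Fin as Fin using (Fin; toℕ)
open import Data.Vec as Vec using (Vec; []; _∷_; lookup; tabulate; _++_; reverse; updateAt)
open import Data.List as List using (List; []; _∷_; concatMap; filterᵇ; foldr)
open import Data.Product using (Σ; ∃; _×_; _,_)
open import Relation.Nullary using (¬_; does)
open import Data.Bool.ListAction using (and)
open import Data.Nat.ListAction using (sum)
open import Relation.Binary.PropositionalEquality using (_≡_; _≢_)

_==v_ : ∀ {N} → Vec ℕ N → Vec ℕ N → Bool
[] ==v [] = true
(a ∷ as) ==v (b ∷ bs) = (a ℕ.≡ᵇ b) ∧ (as ==v bs)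

sumVec : ∀ {N} → Vec ℕ N → ℕ
sumVec = Vec.foldr _ ℕ._+_ 0

degree : ∀ {N} → Vec ℕ N → ℕ
degree = sumVec

partialSum : ℕ → List ℕ → ℕ
partialSum zero _ = 0
partialSum (suc k) [] = 0
partialSum (suc k) (x ∷ xs) = x ℕ.+ partialSum k xs

insertDec : ℕ → List ℕ → List ℕ
insertDec x [] = x ∷ []
insertDec x (y ∷ ys) = if y ℕ.<ᵇ x then x ∷ y ∷ ys else y ∷ insertDec x ys

sortDec : List ℕ → List ℕ
sortDec = foldr insertDec []

plus : ∀ {N} → Vec ℕ N → List ℕ
plus η = sortDec (Vec.toList η)

PSDominates : List ℕ → List ℕ → Set
PSDominates xs ys = ∀ k → partialSum k ys ℕ.≤ partialSum k xs

_≺_ : ∀ {N} → Vec ℕ N → Vec ℕ N → Set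
_≺_ {N} ν η =
  (η ≢ ν) × (degree η ≡ degree ν) ×
  ( ((plus η ≢ plus ν) × PSDominates (plus η) (plus ν))
  ⊎' ((plus η ≡ plus ν) × PSDominates (Vec.toList η) (Vec.toList ν)) )
  where
  open import Data.Sum using () renaming (_⊎_ to _⊎'_)

countBefore : ∀ {N} → Vec ℕ N → Fin N → ℕ
countBefore {N} η j =
  List.length (filterᵇ (λ i → (toℕ i ℕ.<ᵇ toℕ j) ∧ (lookup η j ℕ.≤ᵇ lookup η i)) (List.allFin N))

countAfter : ∀ {N} → Vec ℕ N → Fin N → ℕ
countAfter {N} η j =
  List.length (filterᵇ (λ i → (toℕ j ℕ.<ᵇ toℕ i) ∧ (lookup η j ℕ.<ᵇ lookup η i)) (List.allFin N))

-- Permutations of {0..N-1} as vectors σ with σ[i] = σ(i)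

allVecs : ∀ N k → List (Vec (Fin N) k)
allVecs N zero = [] ∷ []
allVecs N (suc k) = concatMap (λ v → List.map (λ x → x ∷ v) (List.allFin N)) (allVecs N k)

_==f_ : ∀ {N} → Fin N → Fin N → Bool
i ==f j = toℕ i ℕ.≡ᵇ toℕ j

isInjective : ∀ {N} → Vec (Fin N) N → Bool
isInjective {N} σ =
  and (List.map (λ i → and (List.map (λ j →
     (i ==f j) ∨ not (lookup σ i ==f lookup σ j)) (List.allFin N))) (List.allFin N))

fixesOutside : ∀ {N} → (Fin N → Bool) → Vec (Fin N) N → Bool
fixesOutside {N} K σ = and (List.map (λ i → K i ∨ (lookup σ i ==f i)) (List.allFin N))

permsOn : ∀ N → (Fin N → Bool) → List (Vec (Fin N) N)
permsOn N K = filterᵇ (λ σ → isInjective σ ∧ fixesOutside K σ) (allVecs N N)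

inversions : ∀ {N} → Vec (Fin N) N → ℕ
inversions {N} σ =
  List.length (filterᵇ (λ p → (toℕ (Data.Product.proj₁ p) ℕ.<ᵇ toℕ (Data.Product.proj₂ p))
                             ∧ (toℕ (lookup σ (Data.Product.proj₂ p)) ℕ.<ᵇ toℕ (lookup σ (Data.Product.proj₁ p))))
     (List.cartesianProduct (List.allFin N) (List.allFin N)))
  where import Data.Product

isEven : ℕ → Bool
isEven zero = true
isEven (suc n) = not (isEven n)

-- exponent of x^a after substituting x_i ↦ x_{σ(i)}: b_k = Σ_{i : σ(i)=k} a_i
permExp : ∀ {N} → Vec (Fin N) N → Vec ℕ N → Vec ℕ N
permExp {N} σ a = tabulate (λ k →
  sum (List.map (λ i → if lookup σ i ==f k then lookup a i else 0) (List.allFin N)))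

swapExp : ∀ {N} → Fin N → Fin N → Vec ℕ N → Vec ℕ N
swapExp {N} i j a = tabulate (λ k → if k ==f i then lookup a j else (if k ==f j then lookup a i else lookup a k))

module _ {c ℓ : Level} (R : CommutativeRing c ℓ) where
  open CommutativeRing R

  -- a polynomial is a formal finite sum of terms  coefficient · x^a
  Poly : ℕ → Set c
  Poly N = List (Carrier × Vec ℕ N)

  coeff : ∀ {N} → Poly N → Vec ℕ N → Carrier
  coeff p a = foldr (λ t acc → (if Data.Product.proj₂ t ==v a then Data.Product.proj₁ t else 0#) + acc) 0# p
    where import Data.Product

  _≈P_ : ∀ {N} → Poly N → Poly N → Set ℓ
  p ≈P q = ∀ a → coeff p a ≈ coeff q a

  fromℕ : ℕ → Carrier
  fromℕ zero = 0#
  fromℕ (suc n) = 1# + fromℕ n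

  mono : ∀ {N} → Carrier → Vec ℕ N → Poly N
  mono r a = (r , a) ∷ []

  _+P_ : ∀ {N} → Poly N → Poly N → Poly N
  _+P_ = List._++_

  scale : ∀ {N} → Carrier → Poly N → Poly N
  scale r = List.map (λ { (s , a) → (r * s , a) })

  negP : ∀ {N} → Poly N → Poly N
  negP = scale (- 1#)

  _*P_ : ∀ {N} → Poly N → Poly N → Poly N
  p *P q = concatMap (λ { (r , a) → List.map (λ { (s , b) → (r * s , Vec.zipWith ℕ._+_ a b) }) q }) p

  sumP : ∀ {N} → List (Poly N) → Poly N
  sumP = List.concat

  var : ∀ {N} → Fin N → Poly N
  var {N} i = mono 1# (tabulate (λ k → if k ==f i then 1 else 0))

  xprod : ∀ {N} → Poly N
  xprod = mono 1# (Vec.replicate _ 1)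

  act : ∀ {N} → Vec (Fin N) N → Poly N → Poly N
  act σ = List.map (λ { (r , a) → (r , permExp σ a) })

  sgn : ∀ {N} → Vec (Fin N) N → Carrier
  sgn σ = if isEven (inversions σ) then 1# else - 1#

  Sym : ∀ {N} → (Fin N → Bool) → Poly N → Poly N
  Sym {N} K f = sumP (List.map (λ σ → act σ f) (permsOn N K))

  Asym : ∀ {N} → (Fin N → Bool) → Poly N → Poly N
  Asym {N} K f = sumP (List.map (λ σ → scale (sgn σ) (act σ f)) (permsOn N K))

  setIJ : ∀ {N} → Vec ℕ N → Fin N → ℕ → Fin N → ℕ → Vec ℕ N
  setIJ a i ei j ej = tabulate (λ k → if k ==f i then ei else (if k ==f j then ej else lookup a k))

  -- Divided difference on a monomial (i ≠ j):
  --   D_{ij}(x^a) = (x^a − K_{i,j} x^a) / (x_j − x_i).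
  -- With p = a_j, q = a_i and x^a = x^rest · x_i^q x_j^p:
  --   p > q :  x^rest · Σ_{k=0}^{p−q−1} x_i^{q+(p−q−1−k)} x_j^{q+k}
  --   p < q : −x^rest · Σ_{k=0}^{q−p−1} x_i^{p+k} x_j^{p+(q−p−1−k)}
  --   p = q :  0
  ddMono : ∀ {N} → Fin N → Fin N → Vec ℕ N → Poly N
  ddMono i j a with lookup a j | lookup a i
  ... | p | q =
    if q ℕ.<ᵇ p
    then List.map (λ k → (1# , setIJ a i (q ℕ.+ (p ∸ q ∸ 1 ∸ k)) j (q ℕ.+ k))) (List.upTo (p ∸ q))
    else (if p ℕ.<ᵇ q
    then List.map (λ k → (- 1# , setIJ a i (p ℕ.+ k) j (p ℕ.+ (q ∸ p ∸ 1 ∸ k)))) (List.upTo (q ∸ p))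
    else [])

  dd : ∀ {N} → Fin N → Fin N → Poly N → Poly N
  dd i j f = concatMap (λ { (r , a) → scale r (ddMono i j a) }) f

  euler : ∀ {N} → Fin N → Poly N → Poly N
  euler j = List.map (λ { (r , a) → (fromℕ (lookup a j) * r , a) })

  -- Cherednik operator ξ_j (j is 0-based here, so the constant is −j = −((j+1)−1))
  --   ξ_j = α x_j∂_j + Σ_{i<j} x_j/(x_j−x_i)(1−K_{ij}) + Σ_{i>j} x_i/(x_j−x_i)(1−K_{ij}) − (j−1)
  ξ : ∀ {N} → Carrier → Fin N → Poly N → Poly N
  ξ {N} α j f =
    scale α (euler j f)
    +P (sumP (List.map (λ i →
          if toℕ i ℕ.<ᵇ toℕ j then var j *P dd i j f
          else (if toℕ j ℕ.<ᵇ toℕ i then var i *P dd i j f else []))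
        (List.allFin N))
    +P negP (scale (fromℕ (toℕ j)) f))

  etaBar : ∀ {N} → Carrier → Vec ℕ N → Fin N → Carrier
  etaBar α η j = α * fromℕ (lookup η j) - fromℕ (countBefore η j ℕ.+ countAfter η j)

  IsNSJack : ∀ {N} → Carrier → Vec ℕ N → Poly N → Set ℓ
  IsNSJack α η E =
    (coeff E η ≈ 1#) ×
    (∀ ν → ν ≢ η → ¬ (ν ≺ η) → coeff E ν ≈ 0#) ×
    (∀ j → ξ α j E ≈P scale (etaBar α η j) E)

  -- α generic: q·α + p ≠ 0 for all p ≥ 0, q ≥ 1 (so α ≠ 0 and α not a negative rational)
  Generic : Carrier → Set ℓ
  Generic α = ∀ (p q : ℕ) → ¬ (fromℕ (suc q) * α + fromℕ p ≈ 0#)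

  IsField : Set (c ⊔ ℓ)
  IsField = (¬ (1# ≈ 0#)) × (∀ x → ¬ (x ≈ 0#) → ∃ λ y → x * y ≈ 1#)

  CharZero : Set ℓ
  CharZero = ∀ n → ¬ (fromℕ (suc n) ≈ 0#)

-- Superpartitions Λ = (A ; B), A = (Λ_1..Λ_m), B = (Λ_{m+1}..Λ_N), N = m + n

data SType : Set where
  AS AA SA SS : SType

WeaklyDec : ∀ {k} → Vec ℕ k → Set
WeaklyDec v = ∀ i j → i Fin.< j → lookup v j ℕ.≤ lookup v i

StrictlyDec : ∀ {k} → Vec ℕ k → Set
StrictlyDec v = ∀ i j → i Fin.< j → lookup v j ℕ.< lookup v i

InIndexSet : ∀ {m n} → SType → Vec ℕ m → Vec ℕ n → Set
InIndexSet AS A B = StrictlyDec A × WeaklyDec B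
InIndexSet AA A B = StrictlyDec A × StrictlyDec B
InIndexSet SA A B = WeaklyDec A × StrictlyDec B
InIndexSet SS A B = WeaklyDec A × WeaklyDec B

-- I = {1..m} (0-based: indices < m), J = the rest
inI : ∀ {m n} → Fin (m ℕ.+ n) → Bool
inI {m} i = toℕ i ℕ.<ᵇ m

inJ : ∀ {m n} → Fin (m ℕ.+ n) → Bool
inJ {m} {n} i = not (inI {m} {n} i)

etaOf : ∀ {m n} → Vec ℕ m → Vec ℕ n → Vec ℕ (m ℕ.+ n)
etaOf A B = reverse A ++ reverse B

module _ {c ℓ : Level} (R : CommutativeRing c ℓ) where
  open CommutativeRing R

  symOp : ∀ {m n} → SType → Poly R (m ℕ.+ n) → Poly R (m ℕ.+ n)
  symOp {m} {n} AS f = Asym R (inI {m} {n}) (Sym R (inJ {m} {n}) f)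
  symOp {m} {n} AA f = Asym R (inI {m} {n}) (Asym R (inJ {m} {n}) f)
  symOp {m} {n} SA f = Sym R (inI {m} {n}) (Asym R (inJ {m} {n}) f)
  symOp {m} {n} SS f = Sym R (inI {m} {n}) (Sym R (inJ {m} {n}) f)

  IsSuperJack : Carrier → ∀ {m n} → SType → Vec ℕ m → Vec ℕ n → Poly R (m ℕ.+ n) → Set (c ⊔ ℓ)
  IsSuperJack α {m} {n} T A B P =
    Σ (Poly R _) λ E → IsNSJack R α (etaOf A B) E ×
    Σ Carrier λ k → _≈P_ R P (scale R k (symOp {m} {n} T E)) × (coeff R P (A ++ B) ≈ 1#)

-- For generic α the nonsymmetric Jack polynomial E_η is the only simultaneous eigenvector of the
-- Cherednik operators ξ_j with eigenvalues η̄_j and coefficient 1 at x^η: each ξ_j is triangular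
-- with diagonal entries η̄_j for a well-founded order on compositions of fixed degree (by sum of
-- squares, then by Σ_k k·η_k), and genericity of α together with characteristic zero forces the
-- eigenvalue vectors η̄ and ν̄ of distinct compositions to differ.
-- Multiplying a monomial by x₁⋯x_N commutes with every divided difference and raises the
-- x_j∂_j-eigenvalue by 1, so ξ_j(x₁⋯x_N f) = x₁⋯x_N (ξ_j + α) f; since the eigenvalues of η + 1
-- are η̄ + α, uniqueness gives x₁⋯x_N E_η = E_{η+1}. Finally x₁⋯x_N is symmetric, so it
-- commutes with every (anti)symmetrisation, and comparing coefficients at x^Λ and x^{Λ+1}
-- identifies the two normalising constants.
module Submission where

open import Defs
open import Level using (Level; _⊔_)
open import Algebra.Bundles using (CommutativeRing)
open import Data.Bool.Base using (Bool; true; false; _∧_; _∨_; not; if_then_else_; T)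
import Data.Bool.ListAction
open import Data.Empty using (⊥-elim)
open import Data.Fin.Base as Fin using (Fin; toℕ)
import Data.Fin.Properties as FinP
open import Data.List.Base as List using (List; []; _∷_; filterᵇ; foldr)
import Data.List.Properties as ListP
open import Data.List.Membership.Propositional using (_∈_)
open import Data.List.Membership.Propositional.Properties using (∈-allFin)
open import Data.List.Relation.Unary.Any using (here; there)
open import Data.Nat.Base as ℕ using (ℕ; zero; suc; _∸_; _<_; _≤_; z≤n; s≤s)
import Data.Nat.Induction as ℕInd
import Data.Nat.ListAction
import Data.Nat.Properties as ℕP
open import Data.Nat.Tactic.RingSolver using (solve-∀)
open import Data.Product.Base using (∃; _×_; _,_; proj₁; proj₂)
open import Data.Product.Relation.Binary.Lex.Strict using (×-Lex; ×-wellFounded)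
open import Data.Sum.Base using (_⊎_; inj₁; inj₂)
open import Data.Unit.Base using (tt)
open import Data.Vec.Base as Vec using (Vec; []; _∷_; lookup; tabulate)
import Data.Vec.Properties as VecP
open import Induction.WellFounded using (WellFounded; module Subrelation; module All)
import Relation.Binary.Construct.On as On
open import Relation.Binary.Definitions using (Tri; tri<; tri≈; tri>)
open import Relation.Binary.PropositionalEquality as ≡ using (_≡_; refl; cong; cong₂)
open import Relation.Nullary using (¬_; Dec; yes; no)

T⇒≡true : ∀ {b} → T b → b ≡ true
T⇒≡true {true} _ = refl

≡true⇒T : ∀ {b} → b ≡ true → T b
≡true⇒T refl = tt

≡ᵇ-refl : ∀ m → (m ℕ.≡ᵇ m) ≡ true
≡ᵇ-refl m = T⇒≡true (ℕP.≡⇒≡ᵇ m m refl)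

≡ᵇ-sound : ∀ m n → (m ℕ.≡ᵇ n) ≡ true → m ≡ n
≡ᵇ-sound m n e = ℕP.≡ᵇ⇒≡ m n (≡true⇒T e)

==v-refl : ∀ {N} (v : Vec ℕ N) → (v ==v v) ≡ true
==v-refl [] = refl
==v-refl (x ∷ v) rewrite ≡ᵇ-refl x | ==v-refl v = refl

==v-sound : ∀ {N} (u v : Vec ℕ N) → (u ==v v) ≡ true → u ≡ v
==v-sound [] [] _ = refl
==v-sound (x ∷ u) (y ∷ v) e with x ℕ.≡ᵇ y in eq
... | true = cong₂ _∷_ (≡ᵇ-sound x y eq) (==v-sound u v e)

==v-false : ∀ {N} (u v : Vec ℕ N) → ¬ (u ≡ v) → (u ==v v) ≡ false
==v-false u v u≢v with u ==v v in eq
... | true = ⊥-elim (u≢v (==v-sound u v eq))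
... | false = refl

==v-map-suc : ∀ {N} (u v : Vec ℕ N) → (Vec.map suc u ==v Vec.map suc v) ≡ (u ==v v)
==v-map-suc [] [] = refl
==v-map-suc (x ∷ u) (y ∷ v) = cong ((x ℕ.≡ᵇ y) ∧_) (==v-map-suc u v)

==f-refl : ∀ {n} (i : Fin n) → (i ==f i) ≡ true
==f-refl i = ≡ᵇ-refl (toℕ i)

==f-sound : ∀ {n} (i j : Fin n) → (i ==f j) ≡ true → i ≡ j
==f-sound i j e = FinP.toℕ-injective (≡ᵇ-sound (toℕ i) (toℕ j) e)

==f-false : ∀ {n} (i j : Fin n) → ¬ (i ≡ j) → (i ==f j) ≡ false
==f-false i j i≢j with i ==f j in e
... | true = ⊥-elim (i≢j (==f-sound i j e))
... | false = refl

<ᵇ-sound : ∀ m n → (m ℕ.<ᵇ n) ≡ true → m < n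
<ᵇ-sound m n e = ℕP.<ᵇ⇒< m n (≡true⇒T e)

<ᵇ-false : ∀ m n → (m ℕ.<ᵇ n) ≡ false → n ≤ m
<ᵇ-false m n e = ℕP.≮⇒≥ (λ m<n → ≡.subst T e (ℕP.<⇒<ᵇ m<n))

≤ᵇ-sound : ∀ m n → (m ℕ.≤ᵇ n) ≡ true → m ≤ n
≤ᵇ-sound m n e = ℕP.≤ᵇ⇒≤ m n (≡true⇒T e)

<⇒<ᵇ≡true : ∀ {m n} → m < n → (m ℕ.<ᵇ n) ≡ true
<⇒<ᵇ≡true m<n = T⇒≡true (ℕP.<⇒<ᵇ m<n)

≤⇒≤ᵇ≡true : ∀ {m n} → m ≤ n → (m ℕ.≤ᵇ n) ≡ true
≤⇒≤ᵇ≡true m≤n = T⇒≡true (ℕP.≤⇒≤ᵇ m≤n)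

≥⇒<ᵇ≡false : ∀ {m n} → n ≤ m → (m ℕ.<ᵇ n) ≡ false
≥⇒<ᵇ≡false {m} {n} n≤m with m ℕ.<ᵇ n in e
... | true = ⊥-elim (ℕP.<⇒≱ (<ᵇ-sound m n e) n≤m)
... | false = refl

>⇒≤ᵇ≡false : ∀ {m n} → n < m → (m ℕ.≤ᵇ n) ≡ false
>⇒≤ᵇ≡false {m} {n} n<m with m ℕ.≤ᵇ n in e
... | true = ⊥-elim (ℕP.<⇒≱ n<m (≤ᵇ-sound m n e))
... | false = refl

≤ᵇ≡not<ᵇ : ∀ m n → (m ℕ.≤ᵇ n) ≡ not (n ℕ.<ᵇ m)
≤ᵇ≡not<ᵇ m n with n ℕ.<ᵇ m in e
... | true = >⇒≤ᵇ≡false (<ᵇ-sound n m e)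
... | false = ≤⇒≤ᵇ≡true (<ᵇ-false n m e)

suc≤ᵇsuc : ∀ m n → (suc m ℕ.≤ᵇ suc n) ≡ (m ℕ.≤ᵇ n)
suc≤ᵇsuc zero n = refl
suc≤ᵇsuc (suc m) n = refl

lookup-ext : ∀ {A : Set} {N} (u v : Vec A N) → (∀ k → lookup u k ≡ lookup v k) → u ≡ v
lookup-ext u v h = ≡.trans (≡.sym (VecP.tabulate∘lookup u)) (≡.trans (VecP.tabulate-cong h) (VecP.tabulate∘lookup v))

push-if : ∀ {A B : Set} (f : A → B) (b : Bool) x y → f (if b then x else y) ≡ (if b then f x else f y)
push-if f true x y = refl
push-if f false x y = refl

module _ where
  open import Data.Nat.Base using (_+_; _*_)

  sumFin : ∀ n → (Fin n → ℕ) → ℕ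
  sumFin zero f = 0
  sumFin (suc n) f = f Fin.zero + sumFin n (λ i → f (Fin.suc i))

  𝟙 : Bool → ℕ
  𝟙 b = if b then 1 else 0

  sumFin-cong : ∀ n {f g : Fin n → ℕ} → (∀ i → f i ≡ g i) → sumFin n f ≡ sumFin n g
  sumFin-cong zero e = refl
  sumFin-cong (suc n) e = cong₂ _+_ (e Fin.zero) (sumFin-cong n (λ i → e (Fin.suc i)))

  sumFin-+ : ∀ n (f g : Fin n → ℕ) → sumFin n (λ i → f i + g i) ≡ sumFin n f + sumFin n g
  sumFin-+ zero f g = refl
  sumFin-+ (suc n) f g rewrite sumFin-+ n (λ i → f (Fin.suc i)) (λ i → g (Fin.suc i)) =
    interchange (f Fin.zero) (g Fin.zero) (sumFin n (λ i → f (Fin.suc i))) (sumFin n (λ i → g (Fin.suc i)))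
    where
    interchange : ∀ a b x y → a + b + (x + y) ≡ a + x + (b + y)
    interchange = solve-∀

  sumFin-mono-≤ : ∀ n (f g : Fin n → ℕ) → (∀ k → f k ≤ g k) → sumFin n f ≤ sumFin n g
  sumFin-mono-≤ zero f g f≤g = z≤n
  sumFin-mono-≤ (suc n) f g f≤g = ℕP.+-mono-≤ (f≤g Fin.zero) (sumFin-mono-≤ n _ _ (λ k → f≤g (Fin.suc k)))

  sumFin-mono-< : ∀ n (f g : Fin n → ℕ) → (∀ k → f k ≤ g k) → ∀ k₀ → f k₀ < g k₀ → sumFin n f < sumFin n g
  sumFin-mono-< (suc n) f g f≤g Fin.zero lt = ℕP.+-mono-<-≤ lt (sumFin-mono-≤ n _ _ (λ k → f≤g (Fin.suc k)))
  sumFin-mono-< (suc n) f g f≤g (Fin.suc k₀) lt =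
    ℕP.+-mono-≤-< (f≤g Fin.zero) (sumFin-mono-< n _ _ (λ k → f≤g (Fin.suc k)) k₀ lt)

  sumFin-squares≤square : ∀ n (f : Fin n → ℕ) → sumFin n (λ k → f k * f k) ≤ sumFin n f * sumFin n f
  sumFin-squares≤square zero f = z≤n
  sumFin-squares≤square (suc n) f = ℕP.≤-trans (ℕP.+-monoʳ-≤ (a * a) (sumFin-squares≤square n (λ k → f (Fin.suc k))))
    (≡.subst (a * a + s * s ≤_) (≡.sym (square-+ a s)) (ℕP.m≤m+n _ (2 * (a * s))))
    where
    a = f Fin.zero
    s = sumFin n (λ k → f (Fin.suc k))
    square-+ : ∀ a s → (a + s) * (a + s) ≡ (a * a + s * s) + 2 * (a * s)
    square-+ = solve-∀

  sumFin-override : ∀ n (i : Fin n) (X F : Fin n → ℕ) →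
    sumFin n (λ k → if k ==f i then X k else F k) + F i ≡ sumFin n F + X i
  sumFin-override (suc n) Fin.zero X F = shuffle (X Fin.zero) (sumFin n (λ k → F (Fin.suc k))) (F Fin.zero)
    where
    shuffle : ∀ x s f → x + s + f ≡ f + s + x
    shuffle = solve-∀
  sumFin-override (suc n) (Fin.suc i) X F =
    ≡.trans (ℕP.+-assoc (F Fin.zero) _ _)
      (≡.trans (cong (F Fin.zero +_) (sumFin-override n i (λ k → X (Fin.suc k)) (λ k → F (Fin.suc k))))
               (≡.sym (ℕP.+-assoc (F Fin.zero) _ _)))

  length-filter-allFin : ∀ n (P : Fin n → Bool) → List.length (filterᵇ P (List.allFin n)) ≡ sumFin n (λ i → 𝟙 (P i))
  length-filter-allFin n P = go n (λ i → i)
    where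
    go : ∀ m (f : Fin m → Fin n) → List.length (filterᵇ P (List.tabulate f)) ≡ sumFin m (λ i → 𝟙 (P (f i)))
    go zero f = refl
    go (suc m) f with P (f Fin.zero)
    ... | true = cong suc (go m (λ i → f (Fin.suc i)))
    ... | false = go m (λ i → f (Fin.suc i))

  sum-map-allFin : ∀ n (f : Fin n → ℕ) → Data.Nat.ListAction.sum (List.map f (List.allFin n)) ≡ sumFin n f
  sum-map-allFin n f = go n (λ i → i)
    where
    go : ∀ m (g : Fin m → Fin n) → Data.Nat.ListAction.sum (List.map f (List.tabulate g)) ≡ sumFin m (λ i → f (g i))
    go zero g = refl
    go (suc m) g = cong (f (g Fin.zero) +_) (go m (λ i → g (Fin.suc i)))

  count-below : ∀ n (j : Fin n) → sumFin n (λ i → 𝟙 (toℕ i ℕ.<ᵇ toℕ j)) ≡ toℕ j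
  count-below (suc n) Fin.zero = none n
    where
    none : ∀ n → sumFin n (λ i → 𝟙 (toℕ (Fin.suc i) ℕ.<ᵇ 0)) ≡ 0
    none zero = refl
    none (suc n) = none n
  count-below (suc n) (Fin.suc j) = cong suc (count-below n j)

  count-equal : ∀ n (i₀ : Fin n) → sumFin n (λ i → 𝟙 (i ==f i₀)) ≡ 1
  count-equal (suc n) Fin.zero = cong suc (none n)
    where
    none : ∀ n → sumFin n (λ i → 𝟙 (Fin.suc i ==f Fin.zero {n})) ≡ 0
    none zero = refl
    none (suc n) = none n
  count-equal (suc n) (Fin.suc i₀) = count-equal n i₀

  count-split : ∀ n (P Q : Fin n → Bool) →
    sumFin n (λ i → 𝟙 (P i ∧ Q i)) + sumFin n (λ i → 𝟙 (P i ∧ not (Q i))) ≡ sumFin n (λ i → 𝟙 (P i))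
  count-split n P Q = ≡.trans (≡.sym (sumFin-+ n _ _)) (sumFin-cong n split)
    where
    split : ∀ i → 𝟙 (P i ∧ Q i) + 𝟙 (P i ∧ not (Q i)) ≡ 𝟙 (P i)
    split i with P i | Q i
    ... | true | true = refl
    ... | true | false = refl
    ... | false | _ = refl

-- η̄_j = α η_j − rank j, and rank j is the number of positions ahead of j in the stable
-- decreasing sort of η.
module Rank {N : ℕ} (η : Vec ℕ N) where
  open import Data.Nat.Base using (_+_)

  _▷_ : Fin N → Fin N → Set
  i ▷ j = (lookup η j < lookup η i) ⊎ ((lookup η j ≡ lookup η i) × (toℕ i < toℕ j))

  _▷ᵇ_ : Fin N → Fin N → Bool
  i ▷ᵇ j = ((toℕ i ℕ.<ᵇ toℕ j) ∧ (lookup η j ℕ.≤ᵇ lookup η i))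
        ∨ ((toℕ j ℕ.<ᵇ toℕ i) ∧ (lookup η j ℕ.<ᵇ lookup η i))

  rank : Fin N → ℕ
  rank j = countBefore η j + countAfter η j

  rank≡count : ∀ j → rank j ≡ sumFin N (λ i → 𝟙 (i ▷ᵇ j))
  rank≡count j = ≡.trans (cong₂ _+_ (length-filter-allFin N _) (length-filter-allFin N _))
    (≡.trans (≡.sym (sumFin-+ N _ _)) (sumFin-cong N disjoint))
    where
    disjoint : ∀ i → 𝟙 ((toℕ i ℕ.<ᵇ toℕ j) ∧ (lookup η j ℕ.≤ᵇ lookup η i))
                   + 𝟙 ((toℕ j ℕ.<ᵇ toℕ i) ∧ (lookup η j ℕ.<ᵇ lookup η i)) ≡ 𝟙 (i ▷ᵇ j)
    disjoint i with toℕ i ℕ.<ᵇ toℕ j in i<j | toℕ j ℕ.<ᵇ toℕ i in j<i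
    ... | true | true = ⊥-elim (ℕP.<-asym (<ᵇ-sound (toℕ i) (toℕ j) i<j) (<ᵇ-sound (toℕ j) (toℕ i) j<i))
    ... | true | false with lookup η j ℕ.≤ᵇ lookup η i
    ...   | true = refl
    ...   | false = refl
    disjoint i | false | true with lookup η j ℕ.<ᵇ lookup η i
    ...   | true = refl
    ...   | false = refl
    disjoint i | false | false = refl

  ▷ᵇ-sound : ∀ i j → (i ▷ᵇ j) ≡ true → i ▷ j
  ▷ᵇ-sound i j e with toℕ i ℕ.<ᵇ toℕ j in e₁ | lookup η j ℕ.≤ᵇ lookup η i in e₂
  ... | true | true with ℕP.m≤n⇒m<n∨m≡n (≤ᵇ-sound _ _ e₂)
  ...   | inj₁ lt = inj₁ lt
  ...   | inj₂ eq = inj₂ (eq , <ᵇ-sound _ _ e₁)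
  ▷ᵇ-sound i j e | true | false with toℕ j ℕ.<ᵇ toℕ i in e₃ | lookup η j ℕ.<ᵇ lookup η i in e₄
  ...   | true | true = inj₁ (<ᵇ-sound _ _ e₄)
  ▷ᵇ-sound i j e | false | _ with toℕ j ℕ.<ᵇ toℕ i in e₃ | lookup η j ℕ.<ᵇ lookup η i in e₄
  ...   | true | true = inj₁ (<ᵇ-sound _ _ e₄)

  ▷ᵇ-complete : ∀ i j → i ▷ j → (i ▷ᵇ j) ≡ true
  ▷ᵇ-complete i j (inj₂ (eq , lt)) rewrite <⇒<ᵇ≡true lt | ≤⇒≤ᵇ≡true (ℕP.≤-reflexive eq) = refl
  ▷ᵇ-complete i j (inj₁ lt) with ℕP.<-cmp (toℕ i) (toℕ j)
  ... | tri< i<j _ _ rewrite <⇒<ᵇ≡true i<j | ≤⇒≤ᵇ≡true (ℕP.<⇒≤ lt) = refl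
  ... | tri≈ _ i≡j _ rewrite FinP.toℕ-injective i≡j = ⊥-elim (ℕP.<-irrefl refl lt)
  ... | tri> _ _ j<i rewrite ≥⇒<ᵇ≡false (ℕP.<⇒≤ j<i) | <⇒<ᵇ≡true j<i | <⇒<ᵇ≡true lt = refl

  ▷-irrefl : ∀ i → ¬ (i ▷ i)
  ▷-irrefl i (inj₁ lt) = ℕP.<-irrefl refl lt
  ▷-irrefl i (inj₂ (_ , lt)) = ℕP.<-irrefl refl lt

  ▷⇒≥ : ∀ i j → i ▷ j → lookup η j ≤ lookup η i
  ▷⇒≥ i j (inj₁ lt) = ℕP.<⇒≤ lt
  ▷⇒≥ i j (inj₂ (eq , _)) = ℕP.≤-reflexive eq

  ▷-trans : ∀ i j k → i ▷ j → j ▷ k → i ▷ k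
  ▷-trans i j k (inj₁ a) (inj₁ b) = inj₁ (ℕP.<-trans b a)
  ▷-trans i j k (inj₁ a) (inj₂ (e , _)) = inj₁ (≡.subst (_< lookup η i) (≡.sym e) a)
  ▷-trans i j k (inj₂ (e , _)) (inj₁ b) = inj₁ (≡.subst (lookup η k <_) e b)
  ▷-trans i j k (inj₂ (e , a)) (inj₂ (e' , b)) = inj₂ (≡.trans e' e , ℕP.<-trans a b)

  ▷-connex : ∀ i j → ¬ (i ≡ j) → ¬ (i ▷ j) → j ▷ i
  ▷-connex i j i≢j i⋫j with ℕP.<-cmp (lookup η j) (lookup η i)
  ... | tri< lt _ _ = ⊥-elim (i⋫j (inj₁ lt))
  ... | tri> _ _ gt = inj₁ gt
  ... | tri≈ _ eq _ with ℕP.<-cmp (toℕ i) (toℕ j)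
  ...   | tri< i<j _ _ = ⊥-elim (i⋫j (inj₂ (eq , i<j)))
  ...   | tri≈ _ i≡j _ = ⊥-elim (i≢j (FinP.toℕ-injective i≡j))
  ...   | tri> _ _ j<i = inj₂ (≡.sym eq , j<i)

  rank-mono : ∀ i j → i ▷ j → rank i < rank j
  rank-mono i j i▷j rewrite rank≡count i | rank≡count j = sumFin-mono-< N _ _ pointwise i atI
    where
    pointwise : ∀ k → 𝟙 (k ▷ᵇ i) ≤ 𝟙 (k ▷ᵇ j)
    pointwise k with k ▷ᵇ i in e
    ... | false = z≤n
    ... | true rewrite ▷ᵇ-complete k j (▷-trans k i j (▷ᵇ-sound k i e) i▷j) = ℕP.≤-refl
    atI : 𝟙 (i ▷ᵇ i) < 𝟙 (i ▷ᵇ j)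
    atI with i ▷ᵇ i in e
    ... | true = ⊥-elim (▷-irrefl i (▷ᵇ-sound i i e))
    ... | false rewrite ▷ᵇ-complete i j i▷j = ℕP.≤-refl

module _ {N : ℕ} where
  open import Data.Nat.Base using (_+_; _*_)
  open Rank using (rank)

  Balanced : ℕ → ℕ → Vec ℕ N → Vec ℕ N → Set
  Balanced d q ν η = ∀ j → d * lookup ν j + q * rank η j ≡ d * lookup η j + q * rank ν j

  balanced-sym : ∀ {d q ν η} → Balanced d q ν η → Balanced d q η ν
  balanced-sym bal j = ≡.sym (bal j)

  -- If i ▷ j in ν but j ▷ i in η, adding the balance equations at i and j gives a strict inequality.
  balanced-▷ : ∀ d q ν η → Balanced (suc d) (suc q) ν η → ∀ i j → Rank._▷_ ν i j → Rank._▷_ η i j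
  balanced-▷ d q ν η bal i j i▷j with Rank._▷ᵇ_ η i j in e
  ... | true = Rank.▷ᵇ-sound η i j e
  ... | false = ⊥-elim (ℕP.<-irrefl (≡.sym lhs≡rhs) rhs<lhs)
    where
    D = suc d
    Q = suc q
    i⋫j : ¬ Rank._▷_ η i j
    i⋫j i▷ηj with ≡.trans (≡.sym e) (Rank.▷ᵇ-complete η i j i▷ηj)
    ... | ()
    i≢j : ¬ (i ≡ j)
    i≢j refl = Rank.▷-irrefl ν i i▷j
    j▷i = Rank.▷-connex η i j i≢j i⋫j
    lhs = (D * lookup ν i + Q * rank η i) + (D * lookup η j + Q * rank ν j)
    rhs = (D * lookup η i + Q * rank ν i) + (D * lookup ν j + Q * rank η j)
    lhs≡rhs : lhs ≡ rhs
    lhs≡rhs = ≡.trans (cong (_+ (D * lookup η j + Q * rank ν j)) (bal i))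
                      (cong ((D * lookup η i + Q * rank ν i) +_) (≡.sym (bal j)))
    rhs<lhs : rhs < lhs
    rhs<lhs = ≡.subst (rhs <_) (ℕP.+-comm (D * lookup η j + Q * rank ν j) (D * lookup ν i + Q * rank η i))
      (ℕP.+-mono-< (ℕP.+-mono-≤-< (ℕP.*-monoʳ-≤ D (Rank.▷⇒≥ η j i j▷i)) (ℕP.*-monoʳ-< Q (Rank.rank-mono ν i j i▷j)))
                   (ℕP.+-mono-≤-< (ℕP.*-monoʳ-≤ D (Rank.▷⇒≥ ν i j i▷j)) (ℕP.*-monoʳ-< Q (Rank.rank-mono η j i j▷i))))

  balanced⇒rank≡ : ∀ d q ν η → Balanced (suc d) (suc q) ν η → ∀ j → rank ν j ≡ rank η j
  balanced⇒rank≡ d q ν η bal j =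
    ≡.trans (Rank.rank≡count ν j) (≡.trans (sumFin-cong N (λ i → cong 𝟙 (same i))) (≡.sym (Rank.rank≡count η j)))
    where
    same : ∀ i → Rank._▷ᵇ_ ν i j ≡ Rank._▷ᵇ_ η i j
    same i with Rank._▷ᵇ_ ν i j in e₁ | Rank._▷ᵇ_ η i j in e₂
    ... | true | true = refl
    ... | false | false = refl
    ... | true | false =
      ≡.trans (≡.sym (Rank.▷ᵇ-complete η i j (balanced-▷ d q ν η bal i j (Rank.▷ᵇ-sound ν i j e₁)))) e₂
    ... | false | true =
      ≡.trans (≡.sym e₁) (Rank.▷ᵇ-complete ν i j
        (balanced-▷ d q η ν (balanced-sym {suc d} {suc q} {ν} {η} bal) i j (Rank.▷ᵇ-sound η i j e₂)))

  balanced⇒≡ : ∀ d q ν η → Balanced (suc d) (suc q) ν η → ν ≡ η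
  balanced⇒≡ d q ν η bal = lookup-ext ν η λ j →
    ℕP.*-cancelˡ-≡ (lookup ν j) (lookup η j) (suc d)
      (ℕP.+-cancelʳ-≡ (suc q * rank η j) _ _
        (≡.trans (bal j) (cong (λ r → suc d * lookup η j + suc q * r) (balanced⇒rank≡ d q ν η bal j))))

countAscendingBefore+countBefore≡index : ∀ {N} (a : Vec ℕ N) j →
  sumFin N (λ i → 𝟙 ((toℕ i ℕ.<ᵇ toℕ j) ∧ (lookup a i ℕ.<ᵇ lookup a j))) ℕ.+ countBefore a j ≡ toℕ j
countAscendingBefore+countBefore≡index {N} a j = ≡.trans
  (cong (sumFin N (λ i → 𝟙 ((toℕ i ℕ.<ᵇ toℕ j) ∧ (lookup a i ℕ.<ᵇ lookup a j))) ℕ.+_) (≡.trans (length-filter-allFin N _)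
    (sumFin-cong N (λ i → cong (λ b → 𝟙 ((toℕ i ℕ.<ᵇ toℕ j) ∧ b)) (≤ᵇ≡not<ᵇ (lookup a j) (lookup a i))))))
  (≡.trans (count-split N (λ i → toℕ i ℕ.<ᵇ toℕ j) (λ i → lookup a i ℕ.<ᵇ lookup a j)) (count-below N j))

countBefore-map-suc : ∀ {N} (η : Vec ℕ N) j → countBefore (Vec.map suc η) j ≡ countBefore η j
countBefore-map-suc {N} η j = ≡.trans (length-filter-allFin N _) (≡.trans (sumFin-cong N pointwise) (≡.sym (length-filter-allFin N _)))
  where
  pointwise : ∀ i → 𝟙 ((toℕ i ℕ.<ᵇ toℕ j) ∧ (lookup (Vec.map suc η) j ℕ.≤ᵇ lookup (Vec.map suc η) i))
                  ≡ 𝟙 ((toℕ i ℕ.<ᵇ toℕ j) ∧ (lookup η j ℕ.≤ᵇ lookup η i))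
  pointwise i rewrite VecP.lookup-map j suc η | VecP.lookup-map i suc η | suc≤ᵇsuc (lookup η j) (lookup η i) = refl

countAfter-map-suc : ∀ {N} (η : Vec ℕ N) j → countAfter (Vec.map suc η) j ≡ countAfter η j
countAfter-map-suc {N} η j = ≡.trans (length-filter-allFin N _) (≡.trans (sumFin-cong N pointwise) (≡.sym (length-filter-allFin N _)))
  where
  pointwise : ∀ i → 𝟙 ((toℕ j ℕ.<ᵇ toℕ i) ∧ (lookup (Vec.map suc η) j ℕ.<ᵇ lookup (Vec.map suc η) i))
                  ≡ 𝟙 ((toℕ j ℕ.<ᵇ toℕ i) ∧ (lookup η j ℕ.<ᵇ lookup η i))
  pointwise i rewrite VecP.lookup-map j suc η | VecP.lookup-map i suc η = refl

-- A well-founded order on compositions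

module _ {N : ℕ} where
  open import Data.Nat.Base using (_+_; _*_)

  total squares moment : Vec ℕ N → ℕ
  total v = sumFin N (lookup v)
  squares v = sumFin N (λ k → lookup v k * lookup v k)
  moment v = sumFin N (λ k → toℕ k * lookup v k)

  infix 4 _⊏_
  _⊏_ : Vec ℕ N → Vec ℕ N → Set
  ν ⊏ a = (total ν ≡ total a) × ((squares ν < squares a) ⊎ ((squares ν ≡ squares a) × (moment a < moment ν)))

  private
    height : Vec ℕ N → ℕ × ℕ
    height v = (total v * total v ∸ squares v , moment v)

    _<ₗₑₓ_ : ℕ × ℕ → ℕ × ℕ → Set
    _<ₗₑₓ_ = ×-Lex _≡_ _<_ _<_

    ⊏⇒height> : ∀ {μ ν} → ν ⊏ μ → height μ <ₗₑₓ height ν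
    ⊏⇒height> {μ} {ν} (t≡ , inj₁ lt) = inj₁ (≡.subst (λ z → z * z ∸ squares μ < total ν * total ν ∸ squares ν) t≡
      (ℕP.∸-monoʳ-< lt (≡.subst (λ z → squares μ ≤ z * z) (≡.sym t≡) (sumFin-squares≤square N (lookup μ)))))
    ⊏⇒height> (t≡ , inj₂ (s≡ , lt)) = inj₂ (cong₂ (λ u v → u * u ∸ v) (≡.sym t≡) (≡.sym s≡) , lt)

  ⊐-wellFounded : WellFounded (λ μ ν → ν ⊏ μ)
  ⊐-wellFounded = Subrelation.wellFounded {_<₁_ = λ μ ν → ν ⊏ μ} {_<₂_ = λ μ ν → height μ <ₗₑₓ height ν}
    (λ {μ} {ν} → ⊏⇒height> {μ} {ν})
    (On.wellFounded height (×-wellFounded ℕInd.<-wellFounded ℕInd.<-wellFounded))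

module _ where
  open import Data.Nat.Base using (_+_; _*_)

  sq₂ : ℕ → ℕ → ℕ
  sq₂ u v = u * u + v * v

  squeeze-squares : ∀ lo s t → sq₂ (lo + suc s) (lo + suc t) < sq₂ lo (lo + suc s + suc t)
  squeeze-squares lo s t = ≡.subst (sq₂ (lo + suc s) (lo + suc t) <_) (≡.sym (expand lo s t)) (ℕP.m<m+n _ (s≤s z≤n))
    where
    expand : ∀ lo s t → lo * lo + (lo + suc s + suc t) * (lo + suc s + suc t)
                      ≡ ((lo + suc s) * (lo + suc s) + (lo + suc t) * (lo + suc t)) + 2 * (suc s * suc t)
    expand = solve-∀

  rearrangement-< : ∀ i j p q → i < j → p < q → i * q + j * p < i * p + j * q
  rearrangement-< i j p q i<j p<q with ℕP.m≤n⇒∃[o]m+o≡n i<j | ℕP.m≤n⇒∃[o]m+o≡n p<q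
  ... | (s , refl) | (t , refl) = ≡.subst (i * (suc p + t) + (suc i + s) * p <_) (≡.sym (expand i s p t)) (ℕP.m<m+n _ (s≤s z≤n))
    where
    expand : ∀ i s p t → i * p + (suc i + s) * (suc p + t) ≡ (i * (suc p + t) + (suc i + s) * p) + (suc s * suc t)
    expand = solve-∀

  m+1+[n∸1+m]≡n : ∀ {m n} → m < n → m + suc (n ∸ suc m) ≡ n
  m+1+[n∸1+m]≡n {m} {n} m<n = ≡.trans (ℕP.+-suc m (n ∸ suc m)) (ℕP.m+[n∸m]≡n m<n)

  n∸m≡1+[n∸m∸1] : ∀ m n → m < n → n ∸ m ≡ suc (n ∸ m ∸ 1)
  n∸m≡1+[n∸m∸1] zero (suc n) _ = refl
  n∸m≡1+[n∸m∸1] (suc m) (suc n) (s≤s m<n) = n∸m≡1+[n∸m∸1] m n m<n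

  m+1+[n∸m∸1]≡n : ∀ m n → m < n → m + suc (n ∸ m ∸ 1) ≡ n
  m+1+[n∸m∸1]≡n m n m<n = ≡.trans (cong (m +_) (≡.sym (n∸m≡1+[n∸m∸1] m n m<n))) (ℕP.m+[n∸m]≡n (ℕP.<⇒≤ m<n))

  n∸k≡1+[n∸1+k] : ∀ k n → k < n → n ∸ k ≡ suc (n ∸ suc k)
  n∸k≡1+[n∸1+k] zero (suc n) _ = refl
  n∸k≡1+[n∸1+k] (suc k) (suc n) (s≤s k<n) = n∸k≡1+[n∸1+k] k n k<n

  split-above : ∀ lo n k → k < n → lo + suc n ≡ lo + suc (n ∸ suc k) + suc k
  split-above lo n k k<n = ≡.trans (cong (λ z → lo + suc z) (≡.sym (ℕP.m∸n+n≡m k<n))) (reassoc lo (n ∸ suc k) k)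
    where
    reassoc : ∀ lo s k → lo + suc (s + suc k) ≡ lo + suc s + suc k
    reassoc = solve-∀

  split-above′ : ∀ lo n k → k < n → lo + suc n ≡ lo + suc k + suc (n ∸ suc k)
  split-above′ lo n k k<n = ≡.trans (split-above lo n k k<n) (swap lo (n ∸ suc k) k)
    where
    swap : ∀ lo s k → lo + suc s + suc k ≡ lo + suc k + suc s
    swap = solve-∀

module _ {N : ℕ} where
  open import Data.Nat.Base using (_+_; _*_)

  -- setIJ of Defs, without its (unused) ring parameter
  setAt₂ : Vec ℕ N → Fin N → ℕ → Fin N → ℕ → Vec ℕ N
  setAt₂ a i x j y = tabulate (λ k → if k ==f i then x else (if k ==f j then y else lookup a k))

  unitVec : Fin N → Vec ℕ N
  unitVec v = tabulate (λ k → if k ==f v then 1 else 0)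

  record Updates (b a : Vec ℕ N) (i : Fin N) (x : ℕ) (j : Fin N) (y : ℕ) : Set where
    constructor updates
    field lookup-Updates : ∀ k → lookup b k ≡ (if k ==f i then x else (if k ==f j then y else lookup a k))
  open Updates

  sumFin-Updates : ∀ (h : Fin N → ℕ → ℕ) (a b : Vec ℕ N) i x j y → ¬ (i ≡ j) → Updates b a i x j y →
    sumFin N (λ k → h k (lookup b k)) + (h i (lookup a i) + h j (lookup a j))
      ≡ sumFin N (λ k → h k (lookup a k)) + (h i x + h j y)
  sumFin-Updates h a b i x j y i≢j upd = begin
      sumFin N (λ k → h k (lookup b k)) + (h i (lookup a i) + h j (lookup a j))
        ≡⟨ cong (λ z → z + (h i (lookup a i) + h j (lookup a j)))
                (sumFin-cong N (λ k → ≡.trans (cong (h k) (lookup-Updates upd k)) (push-if (h k) (k ==f i) x _))) ⟩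
      Sᵢ + (h i (lookup a i) + h j (lookup a j))
        ≡⟨ cong (λ z → Sᵢ + (z + h j (lookup a j))) (≡.sym Fⱼ-at-i) ⟩
      Sᵢ + (Fⱼ i + h j (lookup a j))
        ≡⟨ ≡.sym (ℕP.+-assoc Sᵢ (Fⱼ i) (h j (lookup a j))) ⟩
      (Sᵢ + Fⱼ i) + h j (lookup a j)
        ≡⟨ cong (_+ h j (lookup a j)) (sumFin-override N i (λ k → h k x) Fⱼ) ⟩
      (sumFin N Fⱼ + h i x) + h j (lookup a j)
        ≡⟨ swap₂₃ (sumFin N Fⱼ) (h i x) (h j (lookup a j)) ⟩
      (sumFin N Fⱼ + h j (lookup a j)) + h i x
        ≡⟨ cong (_+ h i x) (≡.trans (cong (_+ h j (lookup a j)) (sumFin-cong N (λ k → push-if (h k) (k ==f j) y (lookup a k))))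
                                    (sumFin-override N j (λ k → h k y) (λ k → h k (lookup a k)))) ⟩
      (sumFin N (λ k → h k (lookup a k)) + h j y) + h i x
        ≡⟨ reassoc _ (h j y) (h i x) ⟩
      sumFin N (λ k → h k (lookup a k)) + (h i x + h j y) ∎
    where
    open ≡.≡-Reasoning
    Fⱼ : Fin N → ℕ
    Fⱼ k = h k (if k ==f j then y else lookup a k)
    Sᵢ = sumFin N (λ k → if k ==f i then h k x else Fⱼ k)
    Fⱼ-at-i : Fⱼ i ≡ h i (lookup a i)
    Fⱼ-at-i rewrite ==f-false i j i≢j = refl
    swap₂₃ : ∀ s u v → s + u + v ≡ s + v + u
    swap₂₃ = solve-∀
    reassoc : ∀ s u v → s + u + v ≡ s + (v + u)
    reassoc = solve-∀

  Updates⇒⊏ : ∀ (a b : Vec ℕ N) i x j y → ¬ (i ≡ j) → Updates b a i x j y → x + y ≡ lookup a i + lookup a j →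
    (x * x + y * y < lookup a i * lookup a i + lookup a j * lookup a j) ⊎
    ((x * x + y * y ≡ lookup a i * lookup a i + lookup a j * lookup a j) ×
     (toℕ i * lookup a i + toℕ j * lookup a j < toℕ i * x + toℕ j * y)) →
    b ⊏ a
  Updates⇒⊏ a b i x j y i≢j upd sum≡ cmp = total≡ , compare cmp
    where
    total≡ : total b ≡ total a
    total≡ = ℕP.+-cancelʳ-≡ (lookup a i + lookup a j) (total b) (total a)
      (≡.trans (sumFin-Updates (λ _ v → v) a b i x j y i≢j upd) (cong (total a +_) sum≡))
    squares-eq = sumFin-Updates (λ _ v → v * v) a b i x j y i≢j upd
    shift-< : ∀ s t A B → s + A ≡ t + B → B < A → s < t
    shift-< s t A B e B<A = ℕP.≰⇒> (λ t≤s → ℕP.<-irrefl (≡.sym e) (ℕP.+-mono-≤-< t≤s B<A))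
    compare : _ → (squares b < squares a) ⊎ ((squares b ≡ squares a) × (moment a < moment b))
    compare (inj₁ lt) = inj₁ (shift-< (squares b) (squares a) _ _ squares-eq lt)
    compare (inj₂ (e , lt)) = inj₂ (ℕP.+-cancelʳ-≡ _ (squares b) (squares a) (≡.trans squares-eq (cong (squares a +_) e)) ,
      shift-< (moment a) (moment b) _ _ (≡.sym (sumFin-Updates (λ k v → toℕ k * v) a b i x j y i≢j upd)) lt)

  -- Moving two entries strictly inside the interval they span, keeping their sum, lowers the sum of squares.
  squeeze-⊏ : ∀ (a b : Vec ℕ N) i x j y → ¬ (i ≡ j) → Updates b a i x j y → ∀ lo s t →
    x ≡ lo + suc s → y ≡ lo + suc t → lookup a i ≡ lo → lookup a j ≡ lo + suc s + suc t → b ⊏ a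
  squeeze-⊏ a b i x j y i≢j upd lo s t refl refl aᵢ aⱼ = Updates⇒⊏ a b i _ j _ i≢j upd
    (≡.trans (sums lo s t) (≡.sym (cong₂ _+_ aᵢ aⱼ)))
    (inj₁ (≡.subst (sq₂ (lo + suc s) (lo + suc t) <_) (≡.sym (cong₂ sq₂ aᵢ aⱼ)) (squeeze-squares lo s t)))
    where
    sums : ∀ lo s t → lo + suc s + (lo + suc t) ≡ lo + (lo + suc s + suc t)
    sums = solve-∀

  squeeze-⊏′ : ∀ (a b : Vec ℕ N) i x j y → ¬ (i ≡ j) → Updates b a i x j y → ∀ lo s t →
    x ≡ lo + suc s → y ≡ lo + suc t → lookup a i ≡ lo + suc s + suc t → lookup a j ≡ lo → b ⊏ a
  squeeze-⊏′ a b i x j y i≢j upd lo s t refl refl aᵢ aⱼ = Updates⇒⊏ a b i _ j _ i≢j upd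
    (≡.trans (sums lo s t) (≡.sym (cong₂ _+_ aᵢ aⱼ)))
    (inj₁ (≡.subst (sq₂ (lo + suc s) (lo + suc t) <_) (≡.sym (≡.trans (cong₂ sq₂ aᵢ aⱼ) (ℕP.+-comm _ (lo * lo))))
      (squeeze-squares lo s t)))
    where
    sums : ∀ lo s t → lo + suc s + (lo + suc t) ≡ (lo + suc s + suc t) + lo
    sums = solve-∀

  swap-⊏ : ∀ (a b : Vec ℕ N) i x j y → ¬ (i ≡ j) → Updates b a i x j y → x ≡ lookup a j → y ≡ lookup a i →
    toℕ i * lookup a i + toℕ j * lookup a j < toℕ i * lookup a j + toℕ j * lookup a i → b ⊏ a
  swap-⊏ a b i x j y i≢j upd refl refl lt = Updates⇒⊏ a b i _ j _ i≢j upd (ℕP.+-comm (lookup a j) (lookup a i))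
    (inj₂ (ℕP.+-comm (lookup a j * lookup a j) (lookup a i * lookup a i) , lt))

  Updates-self⇒≡ : ∀ (a b : Vec ℕ N) i x j y → x ≡ lookup a i → y ≡ lookup a j → Updates b a i x j y → b ≡ a
  Updates-self⇒≡ a b i x j y refl refl upd = lookup-ext b a (λ k → ≡.trans (lookup-Updates upd k) (unchanged k))
    where
    unchanged : ∀ k → (if k ==f i then lookup a i else (if k ==f j then lookup a j else lookup a k)) ≡ lookup a k
    unchanged k with k ==f i in e₁
    ... | true rewrite ==f-sound k i e₁ = refl
    ... | false with k ==f j in e₂
    ...   | true rewrite ==f-sound k j e₂ = refl
    ...   | false = refl

  lookup-unitVec+setAt₂ : ∀ (v : Fin N) a i x j y k → lookup (Vec.zipWith _+_ (unitVec v) (setAt₂ a i x j y)) k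
                          ≡ (if k ==f v then 1 else 0) + (if k ==f i then x else (if k ==f j then y else lookup a k))
  lookup-unitVec+setAt₂ v a i x j y k =
    ≡.trans (VecP.lookup-zipWith _+_ k (unitVec v) (setAt₂ a i x j y)) (cong₂ _+_ (VecP.lookup∘tabulate _ k) (VecP.lookup∘tabulate _ k))

  raiseⱼ-Updates : ∀ (a : Vec ℕ N) i x j y → ¬ (i ≡ j) → Updates (Vec.zipWith _+_ (unitVec j) (setAt₂ a i x j y)) a i x j (suc y)
  raiseⱼ-Updates a i x j y i≢j = updates pointwise
    where
    pointwise : ∀ k → lookup (Vec.zipWith _+_ (unitVec j) (setAt₂ a i x j y)) k
                      ≡ (if k ==f i then x else (if k ==f j then suc y else lookup a k))
    pointwise k rewrite lookup-unitVec+setAt₂ j a i x j y k with k ==f i in e₁ | k ==f j in e₂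
    ... | true | true = ⊥-elim (i≢j (≡.trans (≡.sym (==f-sound k i e₁)) (==f-sound k j e₂)))
    ... | true | false = refl
    ... | false | true = refl
    ... | false | false = refl

  raiseᵢ-Updates : ∀ (a : Vec ℕ N) i x j y → ¬ (i ≡ j) → Updates (Vec.zipWith _+_ (unitVec i) (setAt₂ a i x j y)) a i (suc x) j y
  raiseᵢ-Updates a i x j y i≢j = updates pointwise
    where
    pointwise : ∀ k → lookup (Vec.zipWith _+_ (unitVec i) (setAt₂ a i x j y)) k
                      ≡ (if k ==f i then suc x else (if k ==f j then y else lookup a k))
    pointwise k rewrite lookup-unitVec+setAt₂ i a i x j y k with k ==f i in e₁ | k ==f j in e₂
    ... | true | true = ⊥-elim (i≢j (≡.trans (≡.sym (==f-sound k i e₁)) (==f-sound k j e₂)))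
    ... | true | false = refl
    ... | false | true = refl
    ... | false | false = refl

-- Polynomials as formal sums: coefficients and linear functionals

module Coefficients {c ℓ : Level} (R : CommutativeRing c ℓ) where
  open CommutativeRing R renaming (refl to ≈-refl)
  open import Relation.Binary.Reasoning.Setoid setoid
  open import Algebra.Properties.Ring ring using (-‿distribˡ-*; -‿+-comm; -0#≈0#; -1*x≈-x; +-cancelˡ; +-cancelʳ; x∙y⁻¹≈ε⇒x≈y)
  open import Algebra.Properties.CommutativeSemigroup +-commutativeSemigroup using () renaming (interchange to +-interchange)

  monomial : ∀ {N} → Vec ℕ N → Poly R N
  monomial a = mono R 1# a

  -- the linear functional sending x^a to g a; coefficients are the case g = δ ν
  ⟪_∣_⟫ : ∀ {N} → Poly R N → (Vec ℕ N → Carrier) → Carrier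
  ⟪ f ∣ g ⟫ = foldr (λ t acc → proj₁ t * g (proj₂ t) + acc) 0# f

  δ : ∀ {N} → Vec ℕ N → Vec ℕ N → Carrier
  δ ν a = if a ==v ν then 1# else 0#

  if-cong : ∀ b {x y} → x ≈ y → (if b then x else 0#) ≈ (if b then y else 0#)
  if-cong true x≈y = x≈y
  if-cong false _ = ≈-refl

  if≈*if : ∀ (b : Bool) r → (if b then r else 0#) ≈ r * (if b then 1# else 0#)
  if≈*if true r = sym (*-identityʳ r)
  if≈*if false r = sym (zeroʳ r)

  coeff-++ : ∀ {N} (p q : Poly R N) a → coeff R (p List.++ q) a ≈ coeff R p a + coeff R q a
  coeff-++ [] q a = sym (+-identityˡ _)
  coeff-++ (t ∷ p) q a = trans (+-congˡ (coeff-++ p q a)) (sym (+-assoc _ _ _))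

  coeff≈⟪δ⟫ : ∀ {N} (p : Poly R N) ν → coeff R p ν ≈ ⟪ p ∣ δ ν ⟫
  coeff≈⟪δ⟫ [] ν = ≈-refl
  coeff≈⟪δ⟫ (t ∷ p) ν = +-cong (if≈*if (proj₂ t ==v ν) (proj₁ t)) (coeff≈⟪δ⟫ p ν)

  ⟪⟫-++ : ∀ {N} (p q : Poly R N) g → ⟪ p List.++ q ∣ g ⟫ ≈ ⟪ p ∣ g ⟫ + ⟪ q ∣ g ⟫
  ⟪⟫-++ [] q g = sym (+-identityˡ _)
  ⟪⟫-++ (t ∷ p) q g = trans (+-congˡ (⟪⟫-++ p q g)) (sym (+-assoc _ _ _))

  ⟪⟫-cong : ∀ {N} (p : Poly R N) {g h} → (∀ a → g a ≈ h a) → ⟪ p ∣ g ⟫ ≈ ⟪ p ∣ h ⟫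
  ⟪⟫-cong [] g≈h = ≈-refl
  ⟪⟫-cong (t ∷ p) g≈h = +-cong (*-congˡ (g≈h (proj₂ t))) (⟪⟫-cong p g≈h)

  ⟪⟫-+ : ∀ {N} (p : Poly R N) g h → ⟪ p ∣ (λ a → g a + h a) ⟫ ≈ ⟪ p ∣ g ⟫ + ⟪ p ∣ h ⟫
  ⟪⟫-+ [] g h = sym (+-identityˡ _)
  ⟪⟫-+ (t ∷ p) g h = trans (+-cong (distribˡ _ _ _) (⟪⟫-+ p g h)) (+-interchange _ _ _ _)

  ⟪⟫-0 : ∀ {N} (p : Poly R N) → ⟪ p ∣ (λ _ → 0#) ⟫ ≈ 0#
  ⟪⟫-0 [] = ≈-refl
  ⟪⟫-0 (t ∷ p) = trans (+-cong (zeroʳ _) (⟪⟫-0 p)) (+-identityˡ 0#)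

  ⟪⟫-*ˡ : ∀ {N} (p : Poly R N) x g → ⟪ p ∣ (λ a → x * g a) ⟫ ≈ x * ⟪ p ∣ g ⟫
  ⟪⟫-*ˡ [] x g = sym (zeroʳ x)
  ⟪⟫-*ˡ (t ∷ p) x g = trans (+-cong (trans (sym (*-assoc _ _ _)) (trans (*-congʳ (*-comm _ _)) (*-assoc _ _ _))) (⟪⟫-*ˡ p x g))
                           (sym (distribˡ _ _ _))

  ⟪⟫-scale : ∀ {N} x (p : Poly R N) h → ⟪ scale R x p ∣ h ⟫ ≈ x * ⟪ p ∣ h ⟫
  ⟪⟫-scale x [] h = sym (zeroʳ x)
  ⟪⟫-scale x ((s , a) ∷ p) h = trans (+-cong (*-assoc _ _ _) (⟪⟫-scale x p h)) (sym (distribˡ _ _ _))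

  coeff-scale : ∀ {N} x (p : Poly R N) μ → coeff R (scale R x p) μ ≈ x * coeff R p μ
  coeff-scale x p μ = trans (coeff≈⟪δ⟫ (scale R x p) μ) (trans (⟪⟫-scale x p (δ μ)) (*-congˡ (sym (coeff≈⟪δ⟫ p μ))))

  scale-congˡ : ∀ {N x y} (p : Poly R N) → x ≈ y → _≈P_ R (scale R x p) (scale R y p)
  scale-congˡ p x≈y μ = trans (coeff-scale _ p μ) (trans (*-congʳ x≈y) (sym (coeff-scale _ p μ)))

  ⟪⟫-δ : ∀ {N} (p : Poly R N) ν (f : Vec ℕ N → Carrier) → ⟪ p ∣ (λ a → if a ==v ν then f a else 0#) ⟫ ≈ f ν * coeff R p ν
  ⟪⟫-δ [] ν f = sym (zeroʳ _)
  ⟪⟫-δ ((r , b) ∷ p) ν f with b ==v ν in e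
  ... | true rewrite ==v-sound b ν e = trans (+-cong (*-comm r (f ν)) (⟪⟫-δ p ν f)) (sym (distribˡ _ _ _))
  ... | false = trans (+-cong (zeroʳ r) (⟪⟫-δ p ν f)) (trans (+-identityˡ _) (*-congˡ (sym (+-identityˡ _))))

  withoutExp : ∀ {N} → Vec ℕ N → Poly R N → Poly R N
  withoutExp a = filterᵇ (λ t → not (proj₂ t ==v a))

  ⟪⟫-split : ∀ {N} (p : Poly R N) g a → ⟪ p ∣ g ⟫ ≈ coeff R p a * g a + ⟪ withoutExp a p ∣ g ⟫
  ⟪⟫-split [] g a = sym (trans (+-congʳ (zeroˡ _)) (+-identityˡ 0#))
  ⟪⟫-split ((r , b) ∷ p) g a with b ==v a in eq
  ... | true rewrite ==v-sound b a eq = begin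
      r * g a + ⟪ p ∣ g ⟫                                          ≈⟨ +-congˡ (⟪⟫-split p g a) ⟩
      r * g a + (coeff R p a * g a + ⟪ withoutExp a p ∣ g ⟫)        ≈⟨ sym (+-assoc _ _ _) ⟩
      (r * g a + coeff R p a * g a) + ⟪ withoutExp a p ∣ g ⟫        ≈⟨ +-congʳ (sym (distribʳ _ _ _)) ⟩
      (r + coeff R p a) * g a + ⟪ withoutExp a p ∣ g ⟫ ∎
  ... | false = begin
      r * g b + ⟪ p ∣ g ⟫                                          ≈⟨ +-congˡ (⟪⟫-split p g a) ⟩
      r * g b + (coeff R p a * g a + ⟪ withoutExp a p ∣ g ⟫)        ≈⟨ sym (+-assoc _ _ _) ⟩
      (r * g b + coeff R p a * g a) + ⟪ withoutExp a p ∣ g ⟫        ≈⟨ +-congʳ (+-comm _ _) ⟩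
      (coeff R p a * g a + r * g b) + ⟪ withoutExp a p ∣ g ⟫        ≈⟨ +-assoc _ _ _ ⟩
      coeff R p a * g a + (r * g b + ⟪ withoutExp a p ∣ g ⟫)        ≈⟨ +-congʳ (*-congʳ (sym (+-identityˡ _))) ⟩
      (0# + coeff R p a) * g a + (r * g b + ⟪ withoutExp a p ∣ g ⟫) ∎

  coeff-withoutExp-self : ∀ {N} (p : Poly R N) a → coeff R (withoutExp a p) a ≈ 0#
  coeff-withoutExp-self [] a = ≈-refl
  coeff-withoutExp-self ((r , b) ∷ p) a with b ==v a in eq
  ... | true = coeff-withoutExp-self p a
  ... | false rewrite eq = trans (+-identityˡ _) (coeff-withoutExp-self p a)

  coeff-withoutExp-other : ∀ {N} (p : Poly R N) a μ → ¬ (μ ≡ a) → coeff R (withoutExp a p) μ ≈ coeff R p μ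
  coeff-withoutExp-other [] a μ μ≢a = ≈-refl
  coeff-withoutExp-other ((r , b) ∷ p) a μ μ≢a with b ==v a in eq
  ... | true rewrite ==v-sound b a eq | ==v-false a μ (λ e → μ≢a (≡.sym e)) =
    trans (coeff-withoutExp-other p a μ μ≢a) (sym (+-identityˡ _))
  ... | false = +-congˡ (coeff-withoutExp-other p a μ μ≢a)

  length-withoutExp : ∀ {N} (p : Poly R N) a → List.length (withoutExp a p) ≤ List.length p
  length-withoutExp [] a = z≤n
  length-withoutExp ((r , b) ∷ p) a with b ==v a
  ... | true = ℕP.m≤n⇒m≤1+n (length-withoutExp p a)
  ... | false = s≤s (length-withoutExp p a)

  -- Terms with equal exponents are grouped before g is applied, so only the coefficients matter.
  ⟪⟫-vanishes : ∀ {N} (p : Poly R N) (g : Vec ℕ N → Carrier) →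
    (∀ μ → (coeff R p μ ≈ 0#) ⊎ (g μ ≈ 0#)) → ⟪ p ∣ g ⟫ ≈ 0#
  ⟪⟫-vanishes p g = go (List.length p) p g ℕP.≤-refl
    where
    go : ∀ {N} n (p : Poly R N) g → List.length p ≤ n → (∀ μ → (coeff R p μ ≈ 0#) ⊎ (g μ ≈ 0#)) → ⟪ p ∣ g ⟫ ≈ 0#
    go n [] g _ _ = ≈-refl
    go (suc n) ((r , a) ∷ p) g (s≤s len) zero-or = begin
        ⟪ (r , a) ∷ p ∣ g ⟫                                        ≈⟨ ⟪⟫-split ((r , a) ∷ p) g a ⟩
        coeff R ((r , a) ∷ p) a * g a + ⟪ withoutExp a ((r , a) ∷ p) ∣ g ⟫ ≈⟨ +-cong leading rest ⟩
        0# + 0#                                                    ≈⟨ +-identityˡ 0# ⟩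
        0# ∎
      where
      leading : coeff R ((r , a) ∷ p) a * g a ≈ 0#
      leading with zero-or a
      ... | inj₁ e = trans (*-congʳ e) (zeroˡ _)
      ... | inj₂ e = trans (*-congˡ e) (zeroʳ _)
      rest : ⟪ withoutExp a ((r , a) ∷ p) ∣ g ⟫ ≈ 0#
      rest rewrite ==v-refl a = go n (withoutExp a p) g (ℕP.≤-trans (length-withoutExp p a) len) zero-or′
        where
        zero-or′ : ∀ μ → (coeff R (withoutExp a p) μ ≈ 0#) ⊎ (g μ ≈ 0#)
        zero-or′ μ with VecP.≡-dec ℕP._≟_ μ a
        ... | yes refl = inj₁ (coeff-withoutExp-self p a)
        ... | no μ≢a with zero-or μ
        ...   | inj₂ e = inj₂ e
        ...   | inj₁ e = inj₁ (trans (coeff-withoutExp-other p a μ μ≢a) (drop-head e))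
          where
          drop-head : coeff R ((r , a) ∷ p) μ ≈ 0# → coeff R p μ ≈ 0#
          drop-head e rewrite ==v-false a μ (λ e → μ≢a (≡.sym e)) = trans (sym (+-identityˡ _)) e

  x+-1*y≈0⇒x≈y : ∀ {x y} → x + (- 1# * y) ≈ 0# → x ≈ y
  x+-1*y≈0⇒x≈y {x} {y} e = x∙y⁻¹≈ε⇒x≈y x y (trans (+-congˡ (sym (-1*x≈-x y))) e)

  ⟪⟫-resp-≈P : ∀ {N} (p q : Poly R N) h → _≈P_ R p q → ⟪ p ∣ h ⟫ ≈ ⟪ q ∣ h ⟫
  ⟪⟫-resp-≈P p q h p≈q = x+-1*y≈0⇒x≈y (trans (+-congˡ (sym (⟪⟫-scale (- 1#) q h))) (trans (sym (⟪⟫-++ p (negP R q) h))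
      (⟪⟫-vanishes (p List.++ negP R q) h (λ μ → inj₁ (trans (coeff-++ p _ μ)
        (trans (+-congˡ (coeff-scale (- 1#) q μ)) (trans (+-cong (p≈q μ) (-1*x≈-x _)) (-‿inverseʳ _))))))))

  -- A linear operator is determined by its values on monomials; phrased through ⟪_∣_⟫ so that it does
  -- not depend on how a polynomial is listed as terms.
  IsLinear : ∀ {N} → (Poly R N → Poly R N) → Set (c ⊔ ℓ)
  IsLinear Φ = ∀ f h → ⟪ Φ f ∣ h ⟫ ≈ ⟪ f ∣ (λ a → ⟪ Φ (monomial a) ∣ h ⟫) ⟫

  map-linear : ∀ {N} (F : Carrier × Vec ℕ N → Carrier × Vec ℕ N) →
    (∀ s a → proj₁ (F (s , a)) ≈ s * proj₁ (F (1# , a))) →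
    (∀ s a → proj₂ (F (s , a)) ≡ proj₂ (F (1# , a))) → IsLinear (List.map F)
  map-linear F coeff-lin exp-indep [] h = ≈-refl
  map-linear F coeff-lin exp-indep ((s , a) ∷ f) h = +-cong (begin
      proj₁ (F (s , a)) * h (proj₂ (F (s , a)))                ≈⟨ *-cong (coeff-lin s a) (reflexive (cong h (exp-indep s a))) ⟩
      (s * proj₁ (F (1# , a))) * h (proj₂ (F (1# , a)))        ≈⟨ *-assoc _ _ _ ⟩
      s * (proj₁ (F (1# , a)) * h (proj₂ (F (1# , a))))        ≈⟨ *-congˡ (sym (+-identityʳ _)) ⟩
      s * (proj₁ (F (1# , a)) * h (proj₂ (F (1# , a))) + 0#) ∎) (map-linear F coeff-lin exp-indep f h)

  ∘-linear : ∀ {N} {Φ Ψ : Poly R N → Poly R N} → IsLinear Φ → IsLinear Ψ → IsLinear (λ f → Ψ (Φ f))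
  ∘-linear {Φ = Φ} {Ψ} linΦ linΨ f h =
    trans (linΨ (Φ f) h) (trans (linΦ f _) (⟪⟫-cong f (λ a → sym (linΨ (Φ (monomial a)) h))))

  ++-linear : ∀ {N} {Φ Ψ : Poly R N → Poly R N} → IsLinear Φ → IsLinear Ψ → IsLinear (λ f → Φ f List.++ Ψ f)
  ++-linear {Φ = Φ} {Ψ} linΦ linΨ f h = begin
    ⟪ Φ f List.++ Ψ f ∣ h ⟫                                   ≈⟨ ⟪⟫-++ (Φ f) (Ψ f) h ⟩
    ⟪ Φ f ∣ h ⟫ + ⟪ Ψ f ∣ h ⟫                                 ≈⟨ +-cong (linΦ f h) (linΨ f h) ⟩
    ⟪ f ∣ (λ a → ⟪ Φ (monomial a) ∣ h ⟫) ⟫ + ⟪ f ∣ (λ a → ⟪ Ψ (monomial a) ∣ h ⟫) ⟫ ≈⟨ sym (⟪⟫-+ f _ _) ⟩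
    ⟪ f ∣ (λ a → ⟪ Φ (monomial a) ∣ h ⟫ + ⟪ Ψ (monomial a) ∣ h ⟫) ⟫
      ≈⟨ ⟪⟫-cong f (λ a → sym (⟪⟫-++ (Φ (monomial a)) (Ψ (monomial a)) h)) ⟩
    ⟪ f ∣ (λ a → ⟪ Φ (monomial a) List.++ Ψ (monomial a) ∣ h ⟫) ⟫ ∎

  zero-linear : ∀ {N} → IsLinear {N} (λ _ → [])
  zero-linear f h = sym (⟪⟫-0 f)

  concat-linear : ∀ {N} {I : Set} (Φ : I → Poly R N → Poly R N) (L : List I) → (∀ i → IsLinear (Φ i)) →
    IsLinear (λ f → List.concat (List.map (λ i → Φ i f) L))
  concat-linear Φ [] lin = zero-linear
  concat-linear Φ (i ∷ L) lin = ++-linear {Φ = Φ i} {Ψ = λ f → List.concat (List.map (λ i → Φ i f) L)} (lin i) (concat-linear Φ L lin)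

  if-linear : ∀ {N} (b : Bool) {Φ Ψ : Poly R N → Poly R N} → IsLinear Φ → IsLinear Ψ → IsLinear (λ f → if b then Φ f else Ψ f)
  if-linear true linΦ linΨ = linΦ
  if-linear false linΦ linΨ = linΨ

  termwise-linear : ∀ {N} (D : Vec ℕ N → Poly R N) → IsLinear (List.concatMap (λ t → scale R (proj₁ t) (D (proj₂ t))))
  termwise-linear D [] h = ≈-refl
  termwise-linear D ((s , a) ∷ f) h = begin
      ⟪ scale R s (D a) List.++ Dᶠ f ∣ h ⟫                         ≈⟨ ⟪⟫-++ (scale R s (D a)) (Dᶠ f) h ⟩
      ⟪ scale R s (D a) ∣ h ⟫ + ⟪ Dᶠ f ∣ h ⟫                       ≈⟨ +-cong (⟪⟫-scale s (D a) h) (termwise-linear D f h) ⟩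
      s * ⟪ D a ∣ h ⟫ + ⟪ f ∣ (λ b → ⟪ Dᶠ (monomial b) ∣ h ⟫) ⟫     ≈⟨ +-congʳ (*-congˡ (sym on-monomial)) ⟩
      s * ⟪ Dᶠ (monomial a) ∣ h ⟫ + ⟪ f ∣ (λ b → ⟪ Dᶠ (monomial b) ∣ h ⟫) ⟫ ∎
    where
    Dᶠ = List.concatMap (λ t → scale R (proj₁ t) (D (proj₂ t)))
    on-monomial : ⟪ scale R 1# (D a) List.++ [] ∣ h ⟫ ≈ ⟪ D a ∣ h ⟫
    on-monomial = trans (⟪⟫-++ (scale R 1# (D a)) [] h) (trans (+-identityʳ _) (trans (⟪⟫-scale 1# (D a) h) (*-identityˡ _)))

  scale-linear : ∀ {N} x → IsLinear {N} (scale R x)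
  scale-linear x = map-linear _ (λ s a → trans (*-comm x s) (*-congˡ (sym (*-identityʳ x)))) (λ s a → refl)

  euler-linear : ∀ {N} j → IsLinear {N} (euler R j)
  euler-linear j = map-linear _ (λ s a → trans (*-comm _ s) (*-congˡ (sym (*-identityʳ _)))) (λ s a → refl)

  mono*-linear : ∀ {N} r (e : Vec ℕ N) → IsLinear (λ f → _*P_ R (mono R r e) f)
  mono*-linear r e = ++-linear {Φ = List.map (λ t → (r * proj₁ t , Vec.zipWith ℕ._+_ e (proj₂ t)))} {Ψ = λ _ → []}
    (map-linear _ (λ s a → trans (*-comm r s) (*-congˡ (sym (*-identityʳ r)))) (λ s a → refl)) zero-linear

  exchange : ∀ {N} → Fin N → Fin N → Poly R N → Poly R N
  exchange j i f = if toℕ i ℕ.<ᵇ toℕ j then _*P_ R (var R j) (dd R i j f)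
                   else (if toℕ j ℕ.<ᵇ toℕ i then _*P_ R (var R i) (dd R i j f) else [])

  exchange-linear : ∀ {N} (j i : Fin N) → IsLinear (exchange j i)
  exchange-linear j i = if-linear (toℕ i ℕ.<ᵇ toℕ j) {Φ = λ f → _*P_ R (var R j) (dd R i j f)}
    (∘-linear {Φ = dd R i j} {Ψ = _*P_ R (var R j)} (termwise-linear (ddMono R i j)) (mono*-linear _ _))
    (if-linear (toℕ j ℕ.<ᵇ toℕ i) {Φ = λ f → _*P_ R (var R i) (dd R i j f)}
      (∘-linear {Φ = dd R i j} {Ψ = _*P_ R (var R i)} (termwise-linear (ddMono R i j)) (mono*-linear _ _)) zero-linear)

  ξ-linear : ∀ {N} α (j : Fin N) → IsLinear (ξ R α j)
  ξ-linear {N} α j = ++-linear {Φ = λ f → scale R α (euler R j f)}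
    (∘-linear {Φ = euler R j} {Ψ = scale R α} (euler-linear j) (scale-linear α))
    (++-linear {Φ = λ f → List.concat (List.map (λ i → exchange j i f) (List.allFin N))}
      (concat-linear (exchange j) (List.allFin N) (exchange-linear j))
      (∘-linear {Φ = scale R (fromℕ R (toℕ j))} {Ψ = negP R} (scale-linear _) (scale-linear _)))

  coeff-ξ : ∀ {N} α (j : Fin N) f ν → coeff R (ξ R α j f) ν ≈ ⟪ f ∣ (λ a → coeff R (ξ R α j (monomial a)) ν) ⟫
  coeff-ξ α j f ν = trans (coeff≈⟪δ⟫ (ξ R α j f) ν)
    (trans (ξ-linear α j f (δ ν)) (⟪⟫-cong f (λ a → sym (coeff≈⟪δ⟫ (ξ R α j (monomial a)) ν))))

  *-inverseˡ-unique : ∀ {k k₊ s} → k * s ≈ 1# → k₊ * s ≈ 1# → k ≈ k₊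
  *-inverseˡ-unique {k} {k₊} {s} ks≈1 k₊s≈1 = begin
    k              ≈⟨ sym (*-identityʳ k) ⟩
    k * 1#         ≈⟨ *-congˡ (sym k₊s≈1) ⟩
    k * (k₊ * s)   ≈⟨ trans (sym (*-assoc _ _ _)) (trans (*-congʳ (*-comm k k₊)) (*-assoc _ _ _)) ⟩
    k₊ * (k * s)   ≈⟨ *-congˡ ks≈1 ⟩
    k₊ * 1#        ≈⟨ *-identityʳ k₊ ⟩
    k₊             ∎

  fromℕ-+ : ∀ m n → fromℕ R (m ℕ.+ n) ≈ fromℕ R m + fromℕ R n
  fromℕ-+ zero n = sym (+-identityˡ _)
  fromℕ-+ (suc m) n = trans (+-congˡ (fromℕ-+ m n)) (sym (+-assoc _ _ _))

  fromℕ-* : ∀ m n → fromℕ R (m ℕ.* n) ≈ fromℕ R m * fromℕ R n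
  fromℕ-* zero n = sym (zeroˡ _)
  fromℕ-* (suc m) n = trans (fromℕ-+ n (m ℕ.* n)) (trans (+-cong (sym (*-identityˡ _)) (fromℕ-* m n)) (sym (distribʳ _ _ _)))

  x-y≈u-v⇒x+v≈u+y : ∀ {x y u v} → x + - y ≈ u + - v → x + v ≈ u + y
  x-y≈u-v⇒x+v≈u+y {x} {y} {u} {v} e = +-cancelʳ (- y + - v) _ _ (begin
    (x + v) + (- y + - v)   ≈⟨ +-interchange x v (- y) (- v) ⟩
    (x + - y) + (v + - v)   ≈⟨ +-cong e (-‿inverseʳ v) ⟩
    (u + - v) + 0#          ≈⟨ +-congˡ (sym (-‿inverseʳ y)) ⟩
    (u + - v) + (y + - y)   ≈⟨ +-interchange u (- v) y (- y) ⟩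
    (u + y) + (- v + - y)   ≈⟨ +-congˡ (+-comm _ _) ⟩
    (u + y) + (- y + - v)   ∎)

  module _ (isField : IsField R) where

    x*y≈0⇒y≈0 : ∀ {x y} → ¬ (x ≈ 0#) → x * y ≈ 0# → y ≈ 0#
    x*y≈0⇒y≈0 {x} {y} x≉0 xy≈0 with proj₂ isField x x≉0
    ... | (z , xz≈1) = begin
      y           ≈⟨ sym (*-identityˡ y) ⟩
      1# * y      ≈⟨ *-congʳ (sym xz≈1) ⟩
      (x * z) * y ≈⟨ *-congʳ (*-comm x z) ⟩
      (z * x) * y ≈⟨ *-assoc z x y ⟩
      z * (x * y) ≈⟨ *-congˡ xy≈0 ⟩
      z * 0#      ≈⟨ zeroʳ z ⟩
      0#          ∎

    module Separation (charZero : CharZero R) (α : Carrier) (generic : Generic R α) {N : ℕ} where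
      open Rank using (rank)

      ι : ℕ → Carrier
      ι = fromℕ R

      ι-gap : ∀ m k c → ι m * c ≈ ι (m ℕ.+ suc k) * c → c ≈ 0#
      ι-gap m k c e = x*y≈0⇒y≈0 (charZero k) (+-cancelˡ (ι m * c) _ _
        (sym (trans (+-identityʳ _) (trans e (trans (*-congʳ (fromℕ-+ m (suc k))) (distribʳ _ _ _))))))

      ι-distinct : ∀ m n c → ¬ (m ≡ n) → ι m * c ≈ ι n * c → c ≈ 0#
      ι-distinct m n c m≢n e with ℕP.<-cmp m n
      ... | tri≈ _ m≡n _ = ⊥-elim (m≢n m≡n)
      ... | tri< m<n _ _ = ι-gap m (n ∸ suc m) c (trans e (*-congʳ (reflexive (cong ι (≡.sym (m+1+[n∸1+m]≡n m<n))))))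
      ... | tri> _ _ n<m = ι-gap n (m ∸ suc n) c (trans (sym e) (*-congʳ (reflexive (cong ι (≡.sym (m+1+[n∸1+m]≡n n<m))))))

      -- the eigenvalue equations η̄ c = ν̄ c with the subtracted ranks moved across
      EigenBalance : Vec ℕ N → Vec ℕ N → Carrier → Set ℓ
      EigenBalance ν η c = ∀ j → ι (lookup ν j) * (α * c) + ι (rank η j) * c ≈ ι (lookup η j) * (α * c) + ι (rank ν j) * c

      eigenBalance : ∀ ν η c → (∀ j → etaBar R α ν j * c ≈ etaBar R α η j * c) → EigenBalance ν η c
      eigenBalance ν η c eig j = x-y≈u-v⇒x+v≈u+y (trans (sym (expand _ _)) (trans (eig j) (expand _ _)))
        where
        expand : ∀ X V → (α * X - V) * c ≈ X * (α * c) + - (V * c)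
        expand X V = trans (distribʳ c (α * X) (- V)) (+-cong
          (trans (*-assoc α X c) (trans (*-congˡ (*-comm X c)) (trans (sym (*-assoc α c X)) (*-comm (α * c) X))))
          (sym (-‿distribˡ-* V c)))

      generic-kills : ∀ q e c → ι (suc q) * (α * c) + ι e * c ≈ 0# → c ≈ 0#
      generic-kills q e c z = x*y≈0⇒y≈0 (generic e q) (begin
        (ι (suc q) * α + ι e) * c       ≈⟨ distribʳ c _ _ ⟩
        (ι (suc q) * α) * c + ι e * c   ≈⟨ +-congʳ (*-assoc _ _ _) ⟩
        ι (suc q) * (α * c) + ι e * c   ≈⟨ z ⟩
        0#                              ∎)

      -- When Q α c = D c with D, Q > 0, multiplying the balance by Q turns it into a balance in ℕ.
      balance-kills : ∀ ν η d q c → ¬ (ν ≡ η) → ι (suc q) * (α * c) ≈ ι (suc d) * c → EigenBalance ν η c → c ≈ 0#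
      balance-kills ν η d q c ν≢η Qαc≈Dc bal = decide (FinP.all? (λ j → lhs j ℕP.≟ rhs j))
        where
        D = ι (suc d)
        Q = ι (suc q)
        lhs rhs : Fin N → ℕ
        lhs j = suc d ℕ.* lookup ν j ℕ.+ suc q ℕ.* rank η j
        rhs j = suc d ℕ.* lookup η j ℕ.+ suc q ℕ.* rank ν j
        ι-lin : ∀ x w → ι (suc d ℕ.* x ℕ.+ suc q ℕ.* w) ≈ D * ι x + Q * ι w
        ι-lin x w = trans (fromℕ-+ (suc d ℕ.* x) (suc q ℕ.* w)) (+-cong (fromℕ-* (suc d) x) (fromℕ-* (suc q) w))
        scaled : ∀ X W → Q * (X * (α * c) + W * c) ≈ (D * X + Q * W) * c
        scaled X W = begin
          Q * (X * (α * c) + W * c)         ≈⟨ distribˡ _ _ _ ⟩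
          Q * (X * (α * c)) + Q * (W * c)   ≈⟨ +-cong (trans (sym (*-assoc _ _ _)) (trans (*-congʳ (*-comm _ _)) (*-assoc _ _ _)))
                                                       (sym (*-assoc _ _ _)) ⟩
          X * (Q * (α * c)) + (Q * W) * c   ≈⟨ +-congʳ (*-congˡ Qαc≈Dc) ⟩
          X * (D * c) + (Q * W) * c         ≈⟨ +-congʳ (trans (sym (*-assoc _ _ _)) (*-congʳ (*-comm _ _))) ⟩
          (D * X) * c + (Q * W) * c         ≈⟨ sym (distribʳ _ _ _) ⟩
          (D * X + Q * W) * c               ∎
        decide : Dec (∀ j → lhs j ≡ rhs j) → c ≈ 0#
        decide (yes all≡) = ⊥-elim (ν≢η (balanced⇒≡ d q ν η all≡))
        decide (no ¬all≡) with FinP.¬∀⟶∃¬ N _ (λ j → lhs j ℕP.≟ rhs j) ¬all≡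
        ... | (j , lhs≢rhs) = ι-distinct (lhs j) (rhs j) c lhs≢rhs (begin
          ι (lhs j) * c                                         ≈⟨ *-congʳ (ι-lin (lookup ν j) (rank η j)) ⟩
          (D * ι (lookup ν j) + Q * ι (rank η j)) * c           ≈⟨ sym (scaled (ι (lookup ν j)) (ι (rank η j))) ⟩
          Q * (ι (lookup ν j) * (α * c) + ι (rank η j) * c)     ≈⟨ *-congˡ (bal j) ⟩
          Q * (ι (lookup η j) * (α * c) + ι (rank ν j) * c)     ≈⟨ scaled (ι (lookup η j)) (ι (rank ν j)) ⟩
          (D * ι (lookup η j) + Q * ι (rank ν j)) * c           ≈⟨ *-congʳ (sym (ι-lin (lookup η j) (rank ν j))) ⟩
          ι (rhs j) * c                                         ∎)

      separate-at : ∀ ν η j₀ q → lookup ν j₀ ≡ lookup η j₀ ℕ.+ suc q → ¬ (ν ≡ η) → ∀ c → EigenBalance ν η c → c ≈ 0#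
      separate-at ν η j₀ q νⱼ₀ ν≢η c bal = compare (ℕP.<-cmp v u)
        where
        s = α * c
        u = rank η j₀
        v = rank ν j₀
        at-j₀ : ι (suc q) * s + ι u * c ≈ ι v * c
        at-j₀ = +-cancelˡ (ι (lookup η j₀) * s) _ _ (begin
          ι (lookup η j₀) * s + (ι (suc q) * s + ι u * c)   ≈⟨ sym (+-assoc _ _ _) ⟩
          (ι (lookup η j₀) * s + ι (suc q) * s) + ι u * c   ≈⟨ +-congʳ (sym (distribʳ s _ _)) ⟩
          (ι (lookup η j₀) + ι (suc q)) * s + ι u * c
            ≈⟨ +-congʳ (*-congʳ (trans (sym (fromℕ-+ (lookup η j₀) (suc q))) (reflexive (cong ι (≡.sym νⱼ₀))))) ⟩
          ι (lookup ν j₀) * s + ι u * c                     ≈⟨ bal j₀ ⟩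
          ι (lookup η j₀) * s + ι v * c                     ∎)
        generic-case : ∀ e → v ℕ.+ e ≡ u → c ≈ 0#
        generic-case e v+e≡u = generic-kills q e c (+-cancelʳ (ι v * c) _ _ (begin
          (ι (suc q) * s + ι e * c) + ι v * c   ≈⟨ +-assoc _ _ _ ⟩
          ι (suc q) * s + (ι e * c + ι v * c)   ≈⟨ +-congˡ (trans (+-comm _ _) (trans (sym (distribʳ c (ι v) (ι e)))
                                                     (*-congʳ (trans (sym (fromℕ-+ v e)) (reflexive (cong ι v+e≡u)))))) ⟩
          ι (suc q) * s + ι u * c               ≈⟨ at-j₀ ⟩
          ι v * c                               ≈⟨ sym (+-identityˡ _) ⟩
          0# + ι v * c                          ∎))
        compare : Tri (v < u) (v ≡ u) (u < v) → c ≈ 0#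
        compare (tri< v<u _ _) = generic-case (u ∸ v) (ℕP.m+[n∸m]≡n (ℕP.<⇒≤ v<u))
        compare (tri≈ _ v≡u _) = generic-case 0 (≡.trans (ℕP.+-identityʳ v) v≡u)
        compare (tri> _ _ u<v) = balance-kills ν η (v ∸ suc u) q c ν≢η (+-cancelʳ (ι u * c) _ _ (begin
          ι (suc q) * s + ι u * c ≈⟨ at-j₀ ⟩
          ι v * c                 ≈⟨ *-congʳ (trans (reflexive (cong ι (≡.sym (m+1+[n∸1+m]≡n u<v)))) (fromℕ-+ u _)) ⟩
          (ι u + ι D) * c         ≈⟨ trans (distribʳ c (ι u) (ι D)) (+-comm _ _) ⟩
          ι D * c + ι u * c       ∎)) bal
          where
          D = suc (v ∸ suc u)

      etaBar-separates : ∀ (ν η : Vec ℕ N) → ¬ (ν ≡ η) → ∀ c →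
        (∀ j → etaBar R α ν j * c ≈ etaBar R α η j * c) → c ≈ 0#
      etaBar-separates ν η ν≢η c eig with FinP.all? (λ j → lookup ν j ℕP.≟ lookup η j)
      ... | yes all≡ = ⊥-elim (ν≢η (lookup-ext ν η all≡))
      ... | no ¬all≡ with FinP.¬∀⟶∃¬ N _ (λ j → lookup ν j ℕP.≟ lookup η j) ¬all≡
      ...   | (j₀ , νⱼ₀≢ηⱼ₀) with ℕP.<-cmp (lookup η j₀) (lookup ν j₀)
      ...     | tri< lt _ _ = separate-at ν η j₀ _ (≡.sym (m+1+[n∸1+m]≡n lt)) ν≢η c (eigenBalance ν η c eig)
      ...     | tri≈ _ e _ = ⊥-elim (νⱼ₀≢ηⱼ₀ (≡.sym e))
      ...     | tri> _ _ gt = separate-at η ν j₀ _ (≡.sym (m+1+[n∸1+m]≡n gt)) (λ e → ν≢η (≡.sym e)) c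
                                (λ j → sym (eigenBalance ν η c eig j))

-- Triangularity of the Cherednik operators

module Triangularity {c ℓ : Level} (R : CommutativeRing c ℓ) {N : ℕ} where
  open CommutativeRing R renaming (refl to ≈-refl)
  open Coefficients R
  open import Relation.Binary.Reasoning.Setoid setoid
  open import Algebra.Properties.Ring ring using (-‿+-comm; -0#≈0#; -1*x≈-x)
  open import Algebra.Properties.CommutativeSemigroup +-commutativeSemigroup using () renaming (interchange to +-interchange)

  private
    Term : Set c
    Term = Carrier × Vec ℕ N

  BelowOrZero : Carrier → Vec ℕ N → Vec ℕ N → Set ℓ
  BelowOrZero g ν a = (g ≈ 0#) ⊎ (ν ⊏ a)

  record Triangular (L : Poly R N) (d : Carrier) (a ν : Vec ℕ N) : Set (c ⊔ ℓ) where
    constructor triangular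
    field
      remainder : Carrier
      coeff≈diagonal+remainder : coeff R L ν ≈ (if a ==v ν then d else 0#) + remainder
      remainder-below : BelowOrZero remainder ν a

  BelowOrZero-+ : ∀ {g h ν a} → BelowOrZero g ν a → BelowOrZero h ν a → BelowOrZero (g + h) ν a
  BelowOrZero-+ (inj₁ g≈0) (inj₁ h≈0) = inj₁ (trans (+-cong g≈0 h≈0) (+-identityˡ 0#))
  BelowOrZero-+ (inj₂ ν⊏a) _ = inj₂ ν⊏a
  BelowOrZero-+ (inj₁ _) (inj₂ ν⊏a) = inj₂ ν⊏a

  BelowOrZero⇒Triangular : ∀ L d a ν x → coeff R L ν ≡ x → d ≈ 0# → BelowOrZero x ν a → Triangular L d a ν
  BelowOrZero⇒Triangular L d a ν x refl d≈0 below = triangular x (sym (trans (+-congʳ (vanish (a ==v ν))) (+-identityˡ _))) below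
    where
    vanish : ∀ b → (if b then d else 0#) ≈ 0#
    vanish true = d≈0
    vanish false = ≈-refl

  coeff-applyUpTo-below : ∀ a n (τ : ℕ → Term) → (∀ k → k < n → proj₂ (τ k) ⊏ a) → ∀ ν →
    BelowOrZero (coeff R (List.applyUpTo τ n) ν) ν a
  coeff-applyUpTo-below a zero τ below ν = inj₁ ≈-refl
  coeff-applyUpTo-below a (suc n) τ below ν with proj₂ (τ 0) ==v ν in eq
  ... | true = inj₂ (≡.subst (_⊏ a) (==v-sound (proj₂ (τ 0)) ν eq) (below 0 (s≤s z≤n)))
  ... | false with coeff-applyUpTo-below a n (λ k → τ (suc k)) (λ k k<n → below (suc k) (s≤s k<n)) ν
  ...   | inj₁ e = inj₁ (trans (+-identityˡ _) e)
  ...   | inj₂ ν⊏a = inj₂ ν⊏a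

  coeff-upTo-below : ∀ a n (τ : ℕ → Term) → (∀ k → k < n → proj₂ (τ k) ⊏ a) → ∀ ν →
    BelowOrZero (coeff R (List.map τ (List.upTo n)) ν) ν a
  coeff-upTo-below a n τ below ν rewrite ListP.map-upTo τ n = coeff-applyUpTo-below a n τ below ν

  upTo-below-then-diagonal : ∀ a n n' → n ≡ suc n' → (τ : ℕ → Term) → (∀ k → k < n' → proj₂ (τ k) ⊏ a) →
    proj₂ (τ n') ≡ a → ∀ ν → Triangular (List.map τ (List.upTo n)) (proj₁ (τ n')) a ν
  upTo-below-then-diagonal a n n' refl τ below last ν =
    triangular (coeff R (List.map τ (List.upTo n')) ν) split (coeff-upTo-below a n' τ below ν)
    where
    diag = if a ==v ν then proj₁ (τ n') else 0#
    split : coeff R (List.map τ (List.upTo (suc n'))) ν ≈ diag + coeff R (List.map τ (List.upTo n')) ν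
    split = ≡.subst (λ ks → coeff R (List.map τ ks) ν ≈ diag + coeff R (List.map τ (List.upTo n')) ν) (ListP.upTo-∷ʳ n') split′
      where
      split′ : coeff R (List.map τ (List.upTo n' List.∷ʳ n')) ν ≈ diag + coeff R (List.map τ (List.upTo n')) ν
      split′ rewrite ListP.map-++ τ (List.upTo n') (n' ∷ []) =
        trans (coeff-++ (List.map τ (List.upTo n')) (τ n' ∷ []) ν)
          (trans (+-comm _ _) (+-congʳ (trans (+-identityʳ _) (reflexive (cong (λ z → if z ==v ν then proj₁ (τ n') else 0#) last)))))

  coeff-var*ddTerms : ∀ v (τ : ℕ → Term) n ν →
    coeff R (_*P_ R (var R v) (scale R 1# (List.map τ (List.upTo n)) List.++ [])) ν
      ≡ coeff R (List.map (λ k → (1# * (1# * proj₁ (τ k)) , Vec.zipWith ℕ._+_ (unitVec v) (proj₂ (τ k)))) (List.upTo n)) ν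
  coeff-var*ddTerms v τ n ν = cong (λ L → coeff R L ν) (go (List.upTo n))
    where
    go : ∀ ks → _*P_ R (var R v) (scale R 1# (List.map τ ks) List.++ [])
              ≡ List.map (λ k → (1# * (1# * proj₁ (τ k)) , Vec.zipWith ℕ._+_ (unitVec v) (proj₂ (τ k)))) ks
    go [] = refl
    go (k ∷ ks) = cong (_ ∷_) (go ks)

  -- The four shapes of x_v D_ij x^a (v = max(i, j)): every term moves the exponents at i and j
  -- strictly inside the interval they span, except one that returns to a or swaps a_i and a_j.

  xⱼ·ascending-triangular : ∀ (j i : Fin N) (a ν : Vec ℕ N) → ¬ (i ≡ j) → lookup a i < lookup a j →
    Triangular (List.map (λ k → (1# * (1# * 1#) , Vec.zipWith ℕ._+_ (unitVec j)
                  (setAt₂ a i (lookup a i ℕ.+ (lookup a j ∸ lookup a i ∸ 1 ∸ k)) j (lookup a i ℕ.+ k))))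
                (List.upTo (lookup a j ∸ lookup a i))) (1# * (1# * 1#)) a ν
  xⱼ·ascending-triangular j i a ν i≢j q<p =
    upTo-below-then-diagonal a (p ∸ q) n' (n∸m≡1+[n∸m∸1] q p q<p)
      (λ k → (1# * (1# * 1#) , Vec.zipWith ℕ._+_ (unitVec j) (setAt₂ a i (q ℕ.+ (n' ∸ k)) j (q ℕ.+ k)))) below diagonal ν
    where
    q = lookup a i
    p = lookup a j
    n' = p ∸ q ∸ 1
    below : ∀ k → k < n' → Vec.zipWith ℕ._+_ (unitVec j) (setAt₂ a i (q ℕ.+ (n' ∸ k)) j (q ℕ.+ k)) ⊏ a
    below k k<n' = squeeze-⊏ a _ i (q ℕ.+ (n' ∸ k)) j (suc (q ℕ.+ k)) i≢j (raiseⱼ-Updates a i (q ℕ.+ (n' ∸ k)) j (q ℕ.+ k) i≢j)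
      q (n' ∸ suc k) k (cong (q ℕ.+_) (n∸k≡1+[n∸1+k] k n' k<n')) (≡.sym (ℕP.+-suc q k)) refl
      (≡.trans (≡.sym (m+1+[n∸m∸1]≡n q p q<p)) (split-above q n' k k<n'))
    diagonal : Vec.zipWith ℕ._+_ (unitVec j) (setAt₂ a i (q ℕ.+ (n' ∸ n')) j (q ℕ.+ n')) ≡ a
    diagonal = Updates-self⇒≡ a _ i (q ℕ.+ (n' ∸ n')) j (suc (q ℕ.+ n'))
      (≡.trans (cong (q ℕ.+_) (ℕP.n∸n≡0 n')) (ℕP.+-identityʳ q)) (≡.trans (≡.sym (ℕP.+-suc q n')) (m+1+[n∸m∸1]≡n q p q<p))
      (raiseⱼ-Updates a i (q ℕ.+ (n' ∸ n')) j (q ℕ.+ n') i≢j)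

  xⱼ·descending-below : ∀ (j i : Fin N) (a ν : Vec ℕ N) → toℕ i < toℕ j → lookup a j < lookup a i →
    BelowOrZero (coeff R (List.map (λ k → (1# * (1# * - 1#) , Vec.zipWith ℕ._+_ (unitVec j)
                  (setAt₂ a i (lookup a j ℕ.+ k) j (lookup a j ℕ.+ (lookup a i ∸ lookup a j ∸ 1 ∸ k)))))
                (List.upTo (lookup a i ∸ lookup a j))) ν) ν a
  xⱼ·descending-below j i a ν i<j p<q = coeff-upTo-below a (q ∸ p)
    (λ k → (1# * (1# * - 1#) , Vec.zipWith ℕ._+_ (unitVec j) (setAt₂ a i (p ℕ.+ k) j (p ℕ.+ (m' ∸ k))))) below ν
    where
    i≢j : ¬ (i ≡ j)
    i≢j e = ℕP.<-irrefl (cong toℕ e) i<j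
    q = lookup a i
    p = lookup a j
    m' = q ∸ p ∸ 1
    below : ∀ k → k < q ∸ p → Vec.zipWith ℕ._+_ (unitVec j) (setAt₂ a i (p ℕ.+ k) j (p ℕ.+ (m' ∸ k))) ⊏ a
    below zero _ = swap-⊏ a _ i (p ℕ.+ 0) j (suc (p ℕ.+ m')) i≢j (raiseⱼ-Updates a i (p ℕ.+ 0) j (p ℕ.+ m') i≢j)
      (ℕP.+-identityʳ p) (≡.trans (≡.sym (ℕP.+-suc p m')) (m+1+[n∸m∸1]≡n p q p<q)) (rearrangement-< (toℕ i) (toℕ j) p q i<j p<q)
    below (suc s) s<q∸p = squeeze-⊏′ a _ i (p ℕ.+ suc s) j (suc (p ℕ.+ (m' ∸ suc s))) i≢j
      (raiseⱼ-Updates a i (p ℕ.+ suc s) j (p ℕ.+ (m' ∸ suc s)) i≢j)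
      p s (m' ∸ suc s) refl (≡.sym (ℕP.+-suc p (m' ∸ suc s)))
      (≡.trans (≡.sym (m+1+[n∸m∸1]≡n p q p<q)) (split-above′ p m' s s<m')) refl
      where
      s<m' : s < m'
      s<m' = ℕP.≤-pred (≡.subst (suc s <_) (n∸m≡1+[n∸m∸1] p q p<q) s<q∸p)

  xᵢ·ascending-below : ∀ (j i : Fin N) (a ν : Vec ℕ N) → toℕ j < toℕ i → lookup a i < lookup a j →
    BelowOrZero (coeff R (List.map (λ k → (1# * (1# * 1#) , Vec.zipWith ℕ._+_ (unitVec i)
                  (setAt₂ a i (lookup a i ℕ.+ (lookup a j ∸ lookup a i ∸ 1 ∸ k)) j (lookup a i ℕ.+ k))))
                (List.upTo (lookup a j ∸ lookup a i))) ν) ν a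
  xᵢ·ascending-below j i a ν j<i q<p = coeff-upTo-below a (p ∸ q)
    (λ k → (1# * (1# * 1#) , Vec.zipWith ℕ._+_ (unitVec i) (setAt₂ a i (q ℕ.+ (n' ∸ k)) j (q ℕ.+ k)))) below ν
    where
    i≢j : ¬ (i ≡ j)
    i≢j e = ℕP.<-irrefl (cong toℕ (≡.sym e)) j<i
    q = lookup a i
    p = lookup a j
    n' = p ∸ q ∸ 1
    below : ∀ k → k < p ∸ q → Vec.zipWith ℕ._+_ (unitVec i) (setAt₂ a i (q ℕ.+ (n' ∸ k)) j (q ℕ.+ k)) ⊏ a
    below zero _ = swap-⊏ a _ i (suc (q ℕ.+ n')) j (q ℕ.+ 0) i≢j (raiseᵢ-Updates a i (q ℕ.+ n') j (q ℕ.+ 0) i≢j)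
      (≡.trans (≡.sym (ℕP.+-suc q n')) (m+1+[n∸m∸1]≡n q p q<p)) (ℕP.+-identityʳ q)
      (≡.subst₂ _<_ (ℕP.+-comm (toℕ j ℕ.* p) (toℕ i ℕ.* q)) (ℕP.+-comm (toℕ j ℕ.* q) (toℕ i ℕ.* p))
        (rearrangement-< (toℕ j) (toℕ i) q p j<i q<p))
    below (suc s) s<p∸q = squeeze-⊏ a _ i (suc (q ℕ.+ (n' ∸ suc s))) j (q ℕ.+ suc s) i≢j
      (raiseᵢ-Updates a i (q ℕ.+ (n' ∸ suc s)) j (q ℕ.+ suc s) i≢j)
      q (n' ∸ suc s) s (≡.sym (ℕP.+-suc q (n' ∸ suc s))) refl refl (≡.trans (≡.sym (m+1+[n∸m∸1]≡n q p q<p)) (split-above q n' s s<n'))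
      where
      s<n' : s < n'
      s<n' = ℕP.≤-pred (≡.subst (suc s <_) (n∸m≡1+[n∸m∸1] q p q<p) s<p∸q)

  xᵢ·descending-triangular : ∀ (j i : Fin N) (a ν : Vec ℕ N) → toℕ j < toℕ i → lookup a j < lookup a i →
    Triangular (List.map (λ k → (1# * (1# * - 1#) , Vec.zipWith ℕ._+_ (unitVec i)
                  (setAt₂ a i (lookup a j ℕ.+ k) j (lookup a j ℕ.+ (lookup a i ∸ lookup a j ∸ 1 ∸ k)))))
                (List.upTo (lookup a i ∸ lookup a j))) (1# * (1# * - 1#)) a ν
  xᵢ·descending-triangular j i a ν j<i p<q =
    upTo-below-then-diagonal a (q ∸ p) m' (n∸m≡1+[n∸m∸1] p q p<q)
      (λ k → (1# * (1# * - 1#) , Vec.zipWith ℕ._+_ (unitVec i) (setAt₂ a i (p ℕ.+ k) j (p ℕ.+ (m' ∸ k))))) below diagonal ν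
    where
    i≢j : ¬ (i ≡ j)
    i≢j e = ℕP.<-irrefl (cong toℕ (≡.sym e)) j<i
    q = lookup a i
    p = lookup a j
    m' = q ∸ p ∸ 1
    below : ∀ k → k < m' → Vec.zipWith ℕ._+_ (unitVec i) (setAt₂ a i (p ℕ.+ k) j (p ℕ.+ (m' ∸ k))) ⊏ a
    below k k<m' = squeeze-⊏′ a _ i (suc (p ℕ.+ k)) j (p ℕ.+ (m' ∸ k)) i≢j (raiseᵢ-Updates a i (p ℕ.+ k) j (p ℕ.+ (m' ∸ k)) i≢j)
      p k (m' ∸ suc k) (≡.sym (ℕP.+-suc p k)) (cong (p ℕ.+_) (n∸k≡1+[n∸1+k] k m' k<m'))
      (≡.trans (≡.sym (m+1+[n∸m∸1]≡n p q p<q)) (split-above′ p m' k k<m')) refl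
    diagonal : Vec.zipWith ℕ._+_ (unitVec i) (setAt₂ a i (p ℕ.+ m') j (p ℕ.+ (m' ∸ m'))) ≡ a
    diagonal = Updates-self⇒≡ a _ i (suc (p ℕ.+ m')) j (p ℕ.+ (m' ∸ m'))
      (≡.trans (≡.sym (ℕP.+-suc p m')) (m+1+[n∸m∸1]≡n p q p<q)) (≡.trans (cong (p ℕ.+_) (ℕP.n∸n≡0 m')) (ℕP.+-identityʳ p))
      (raiseᵢ-Updates a i (p ℕ.+ m') j (p ℕ.+ (m' ∸ m')) i≢j)

  exchangeDiagonal : Fin N → Fin N → Vec ℕ N → Carrier
  exchangeDiagonal j i a = fromℕ R (𝟙 ((toℕ i ℕ.<ᵇ toℕ j) ∧ (lookup a i ℕ.<ᵇ lookup a j)))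
                         + - fromℕ R (𝟙 ((toℕ j ℕ.<ᵇ toℕ i) ∧ (lookup a j ℕ.<ᵇ lookup a i)))

  private
    diagonal-up : 1# * (1# * 1#) ≈ (1# + 0#) + - 0#
    diagonal-up = trans (*-identityˡ _) (trans (*-identityˡ _) (sym (trans (+-congˡ -0#≈0#) (trans (+-identityʳ _) (+-identityʳ _)))))
    diagonal-down : 1# * (1# * - 1#) ≈ 0# + - (1# + 0#)
    diagonal-down = trans (*-identityˡ _) (trans (*-identityˡ _) (sym (trans (+-identityˡ _) (-‿cong (+-identityʳ _)))))
    diagonal-none : 0# + - 0# ≈ 0#
    diagonal-none = trans (+-identityˡ _) -0#≈0#

  exchange-triangular : ∀ (j i : Fin N) (a ν : Vec ℕ N) → Triangular (exchange j i (monomial a)) (exchangeDiagonal j i a) a ν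
  exchange-triangular j i a ν
    with toℕ i ℕ.<ᵇ toℕ j in i<j | toℕ j ℕ.<ᵇ toℕ i in j<i
       | lookup a i ℕ.<ᵇ lookup a j in aᵢ<aⱼ | lookup a j ℕ.<ᵇ lookup a i in aⱼ<aᵢ
  ... | true | true | _ | _ = ⊥-elim (ℕP.<-asym (<ᵇ-sound (toℕ i) (toℕ j) i<j) (<ᵇ-sound (toℕ j) (toℕ i) j<i))
  ... | _ | _ | true | true = ⊥-elim (ℕP.<-asym (<ᵇ-sound (lookup a i) (lookup a j) aᵢ<aⱼ) (<ᵇ-sound (lookup a j) (lookup a i) aⱼ<aᵢ))
  ... | true | false | true | false
    with xⱼ·ascending-triangular j i a ν i≢j (<ᵇ-sound (lookup a i) (lookup a j) aᵢ<aⱼ)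
    where
    i≢j : ¬ (i ≡ j)
    i≢j e = ℕP.<-irrefl (cong toℕ e) (<ᵇ-sound (toℕ i) (toℕ j) i<j)
  ...   | triangular g eq below = triangular g (trans (reflexive (coeff-var*ddTerms j _ (lookup a j ∸ lookup a i) ν))
                                                     (trans eq (+-congʳ (if-cong (a ==v ν) diagonal-up)))) below
  exchange-triangular j i a ν | true | false | false | true =
    BelowOrZero⇒Triangular _ _ a ν _ (coeff-var*ddTerms j _ (lookup a i ∸ lookup a j) ν) diagonal-none
      (xⱼ·descending-below j i a ν (<ᵇ-sound (toℕ i) (toℕ j) i<j) (<ᵇ-sound (lookup a j) (lookup a i) aⱼ<aᵢ))
  exchange-triangular j i a ν | true | false | false | false = BelowOrZero⇒Triangular _ _ a ν _ refl diagonal-none (inj₁ ≈-refl)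
  exchange-triangular j i a ν | false | true | true | false =
    BelowOrZero⇒Triangular _ _ a ν _ (coeff-var*ddTerms i _ (lookup a j ∸ lookup a i) ν) diagonal-none
      (xᵢ·ascending-below j i a ν (<ᵇ-sound (toℕ j) (toℕ i) j<i) (<ᵇ-sound (lookup a i) (lookup a j) aᵢ<aⱼ))
  exchange-triangular j i a ν | false | true | false | true
    with xᵢ·descending-triangular j i a ν (<ᵇ-sound (toℕ j) (toℕ i) j<i) (<ᵇ-sound (lookup a j) (lookup a i) aⱼ<aᵢ)
  ...   | triangular g eq below = triangular g (trans (reflexive (coeff-var*ddTerms i _ (lookup a i ∸ lookup a j) ν))
                                                     (trans eq (+-congʳ (if-cong (a ==v ν) diagonal-down)))) below
  exchange-triangular j i a ν | false | true | false | false = BelowOrZero⇒Triangular _ _ a ν _ refl diagonal-none (inj₁ ≈-refl)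
  exchange-triangular j i a ν | false | false | _ | _ = BelowOrZero⇒Triangular _ _ a ν _ refl diagonal-none (inj₁ ≈-refl)

  exchangeDiagonalSum : Fin N → Vec ℕ N → List (Fin N) → Carrier
  exchangeDiagonalSum j a = foldr (λ i acc → exchangeDiagonal j i a + acc) 0#

  exchanges-triangular : ∀ (j : Fin N) (a ν : Vec ℕ N) (L : List (Fin N)) →
    Triangular (List.concat (List.map (λ i → exchange j i (monomial a)) L)) (exchangeDiagonalSum j a L) a ν
  exchanges-triangular j a ν [] = triangular 0# (sym (trans (+-congʳ (vanish (a ==v ν))) (+-identityˡ 0#))) (inj₁ ≈-refl)
    where
    vanish : ∀ b → (if b then 0# else 0#) ≈ 0#
    vanish true = ≈-refl
    vanish false = ≈-refl
  exchanges-triangular j a ν (i ∷ L) with exchange-triangular j i a ν | exchanges-triangular j a ν L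
  ... | triangular g e below | triangular G E Below =
    triangular (g + G) (trans (coeff-++ (exchange j i (monomial a)) _ ν) (trans (+-cong e E) (regroup (a ==v ν) g G)))
      (BelowOrZero-+ {g} {G} {ν} {a} below Below)
    where
    regroup : ∀ b g G → ((if b then exchangeDiagonal j i a else 0#) + g) + ((if b then exchangeDiagonalSum j a L else 0#) + G)
                        ≈ (if b then exchangeDiagonal j i a + exchangeDiagonalSum j a L else 0#) + (g + G)
    regroup true g G = +-interchange _ g _ G
    regroup false g G = trans (+-interchange 0# g 0# G) (+-congʳ (+-identityˡ 0#))

  exchangeDiagonalSum-tabulate : ∀ (j : Fin N) a n (f : Fin n → Fin N) →
    exchangeDiagonalSum j a (List.tabulate f)
      ≈ fromℕ R (sumFin n (λ k → 𝟙 ((toℕ (f k) ℕ.<ᵇ toℕ j) ∧ (lookup a (f k) ℕ.<ᵇ lookup a j))))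
        + - fromℕ R (sumFin n (λ k → 𝟙 ((toℕ j ℕ.<ᵇ toℕ (f k)) ∧ (lookup a j ℕ.<ᵇ lookup a (f k)))))
  exchangeDiagonalSum-tabulate j a zero f = sym (trans (+-congˡ -0#≈0#) (+-identityʳ _))
  exchangeDiagonalSum-tabulate j a (suc n) f =
    trans (+-congˡ (exchangeDiagonalSum-tabulate j a n (λ k → f (Fin.suc k))))
      (trans (+-interchange _ _ _ _) (+-cong (sym (fromℕ-+ (P Fin.zero) (sumFin n (λ k → P (Fin.suc k)))))
        (trans (-‿+-comm _ _) (-‿cong (sym (fromℕ-+ (Q Fin.zero) (sumFin n (λ k → Q (Fin.suc k)))))))))
    where
    P Q : Fin (suc n) → ℕ
    P k = 𝟙 ((toℕ (f k) ℕ.<ᵇ toℕ j) ∧ (lookup a (f k) ℕ.<ᵇ lookup a j))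
    Q k = 𝟙 ((toℕ j ℕ.<ᵇ toℕ (f k)) ∧ (lookup a j ℕ.<ᵇ lookup a (f k)))

  ξ-diagonal : ∀ α (j : Fin N) (a : Vec ℕ N) →
    α * (fromℕ R (lookup a j) * 1#) + (exchangeDiagonalSum j a (List.allFin N) + - 1# * (fromℕ R (toℕ j) * 1#)) ≈ etaBar R α a j
  ξ-diagonal α j a = begin
    α * (ι (lookup a j) * 1#) + (exchangeDiagonalSum j a (List.allFin N) + - 1# * (ι (toℕ j) * 1#))
      ≈⟨ +-cong (*-congˡ (*-identityʳ _)) (+-cong (exchangeDiagonalSum-tabulate j a N (λ i → i))
                                                  (trans (-1*x≈-x _) (-‿cong (*-identityʳ _)))) ⟩
    α * ι (lookup a j) + ((ι ascending + - ι descending) + - ι (toℕ j))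
      ≈⟨ +-congˡ (+-congˡ (-‿cong (trans (reflexive (cong ι (≡.sym (countAscendingBefore+countBefore≡index a j))))
                                            (fromℕ-+ ascending (countBefore a j))))) ⟩
    α * ι (lookup a j) + ((ι ascending + - ι descending) + - (ι ascending + ι (countBefore a j)))
      ≈⟨ +-congˡ (cancel _ _ _) ⟩
    α * ι (lookup a j) + - (ι (countBefore a j) + ι descending)
      ≈⟨ +-congˡ (-‿cong (sym (trans (fromℕ-+ (countBefore a j) (countAfter a j))
                                      (+-congˡ (reflexive (cong ι (length-filter-allFin N _))))))) ⟩
    α * ι (lookup a j) + - ι (countBefore a j ℕ.+ countAfter a j) ∎
    where
    ι = fromℕ R
    ascending = sumFin N (λ i → 𝟙 ((toℕ i ℕ.<ᵇ toℕ j) ∧ (lookup a i ℕ.<ᵇ lookup a j)))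
    descending = sumFin N (λ i → 𝟙 ((toℕ j ℕ.<ᵇ toℕ i) ∧ (lookup a j ℕ.<ᵇ lookup a i)))
    cancel : ∀ x y z → (x + - y) + - (x + z) ≈ - (z + y)
    cancel x y z = begin
      (x + - y) + - (x + z)     ≈⟨ +-congˡ (sym (-‿+-comm x z)) ⟩
      (x + - y) + (- x + - z)   ≈⟨ +-interchange x (- y) (- x) (- z) ⟩
      (x + - x) + (- y + - z)   ≈⟨ +-cong (-‿inverseʳ x) (-‿+-comm y z) ⟩
      0# + - (y + z)            ≈⟨ +-identityˡ _ ⟩
      - (y + z)                 ≈⟨ -‿cong (+-comm y z) ⟩
      - (z + y)                 ∎

  ξ-triangular : ∀ α (j : Fin N) (a ν : Vec ℕ N) → Triangular (ξ R α j (monomial a)) (etaBar R α a j) a ν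
  ξ-triangular α j a ν with exchanges-triangular j a ν (List.allFin N)
  ... | triangular G E below = triangular G (begin
      coeff R (euler-part List.++ (exchange-part List.++ constant-part)) ν
        ≈⟨ trans (coeff-++ euler-part (exchange-part List.++ constant-part) ν) (+-congˡ (coeff-++ exchange-part constant-part ν)) ⟩
      coeff R euler-part ν + (coeff R exchange-part ν + coeff R constant-part ν)
        ≈⟨ +-congˡ (+-congʳ E) ⟩
      _ ≈⟨ regroup (a ==v ν) _ _ _ ⟩
      _ ≈⟨ +-congʳ (if-cong (a ==v ν) (ξ-diagonal α j a)) ⟩
      (if a ==v ν then etaBar R α a j else 0#) + G ∎) below
    where
    euler-part = scale R α (euler R j (monomial a))
    exchange-part = List.concat (List.map (λ i → exchange j i (monomial a)) (List.allFin N))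
    constant-part = negP R (scale R (fromℕ R (toℕ j)) (monomial a))
    regroup : ∀ b x D y → ((if b then x else 0#) + 0#) + (((if b then D else 0#) + G) + ((if b then y else 0#) + 0#))
                          ≈ (if b then x + (D + y) else 0#) + G
    regroup true x D y = begin
      (x + 0#) + ((D + G) + (y + 0#)) ≈⟨ +-cong (+-identityʳ x) (+-congˡ (+-identityʳ y)) ⟩
      x + ((D + G) + y)               ≈⟨ +-congˡ (trans (+-assoc D G y) (trans (+-congˡ (+-comm G y)) (sym (+-assoc D y G)))) ⟩
      x + ((D + y) + G)               ≈⟨ sym (+-assoc _ _ _) ⟩
      (x + (D + y)) + G               ∎
    regroup false x D y = begin
      (0# + 0#) + ((0# + G) + (0# + 0#)) ≈⟨ +-cong (+-identityˡ 0#) (+-cong (+-identityˡ G) (+-identityˡ 0#)) ⟩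
      0# + (G + 0#)                      ≈⟨ +-congˡ (+-identityʳ G) ⟩
      0# + G                             ∎

-- Uniqueness of eigenfunctions

module _ {c ℓ : Level} (R : CommutativeRing c ℓ) (isField : IsField R) (charZero : CharZero R)
         (α : CommutativeRing.Carrier R) (generic : Generic R α) {N : ℕ} where
  open CommutativeRing R hiding (refl)
  open import Relation.Binary.Reasoning.Setoid setoid
  open Coefficients R
  open Triangularity R {N}
  open import Algebra.Properties.Ring ring using (-1*x≈-x)
  open Separation isField charZero α generic {N} using (etaBar-separates)

  -- The coefficient of x^ν in ξ_j F is ν̄_j F_ν plus contributions of exponents μ above ν, which
  -- vanish by induction from the top; so ν̄ F_ν = η̄ F_ν, forcing F_ν = 0 unless ν = η.
  eigenfunction-vanishes : ∀ (η : Vec ℕ N) (F : Poly R N) → coeff R F η ≈ 0# →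
    (∀ j ν → coeff R (ξ R α j F) ν ≈ etaBar R α η j * coeff R F ν) → ∀ ν → coeff R F ν ≈ 0#
  eigenfunction-vanishes η F Fη≈0 eigen = All.wfRec ⊐-wellFounded _ (λ ν → coeff R F ν ≈ 0#) step
    where
    step : ∀ ν → (∀ {μ} → ν ⊏ μ → coeff R F μ ≈ 0#) → coeff R F ν ≈ 0#
    step ν above with VecP.≡-dec ℕP._≟_ ν η
    ... | yes refl = Fη≈0
    ... | no ν≢η = etaBar-separates ν η ν≢η (coeff R F ν) λ j → begin
        etaBar R α ν j * coeff R F ν
          ≈⟨ sym (⟪⟫-δ F ν (λ a → etaBar R α a j)) ⟩
        ⟪ F ∣ diagonal j ⟫
          ≈⟨ sym (+-identityʳ _) ⟩
        ⟪ F ∣ diagonal j ⟫ + 0#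
          ≈⟨ +-congˡ (sym (⟪⟫-vanishes F (remainder j) (remainder-negligible j))) ⟩
        ⟪ F ∣ diagonal j ⟫ + ⟪ F ∣ remainder j ⟫
          ≈⟨ sym (⟪⟫-+ F (diagonal j) (remainder j)) ⟩
        ⟪ F ∣ (λ a → diagonal j a + remainder j a) ⟫
          ≈⟨ ⟪⟫-cong F (λ a → sym (Triangular.coeff≈diagonal+remainder (ξ-triangular α j a ν))) ⟩
        ⟪ F ∣ (λ a → coeff R (ξ R α j (monomial a)) ν) ⟫
          ≈⟨ sym (coeff-ξ α j F ν) ⟩
        coeff R (ξ R α j F) ν
          ≈⟨ eigen j ν ⟩
        etaBar R α η j * coeff R F ν ∎
      where
      diagonal remainder : Fin N → Vec ℕ N → CommutativeRing.Carrier R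
      diagonal j a = if a ==v ν then etaBar R α a j else 0#
      remainder j a = Triangular.remainder (ξ-triangular α j a ν)
      remainder-negligible : ∀ j μ → (coeff R F μ ≈ 0#) ⊎ (remainder j μ ≈ 0#)
      remainder-negligible j μ with Triangular.remainder-below (ξ-triangular α j μ ν)
      ... | inj₁ r≈0 = inj₂ r≈0
      ... | inj₂ ν⊏μ = inj₁ (above ν⊏μ)

  eigenfunctions-agree : ∀ (η : Vec ℕ N) (P Q : Poly R N) → coeff R P η ≈ coeff R Q η →
    (∀ j ν → coeff R (ξ R α j P) ν ≈ etaBar R α η j * coeff R P ν) →
    (∀ j ν → coeff R (ξ R α j Q) ν ≈ etaBar R α η j * coeff R Q ν) → _≈P_ R P Q
  eigenfunctions-agree η P Q Pη≈Qη eigenP eigenQ ν =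
    x+-1*y≈0⇒x≈y (trans (sym (coeff-P-Q ν)) (eigenfunction-vanishes η (P List.++ negP R Q)
      (trans (coeff-P-Q η) (trans (+-congˡ (-1*x≈-x _)) (trans (+-congʳ Pη≈Qη) (-‿inverseʳ _))))
      eigen ν))
    where
    coeff-P-Q : ∀ μ → coeff R (P List.++ negP R Q) μ ≈ coeff R P μ + - 1# * coeff R Q μ
    coeff-P-Q μ = trans (coeff-++ P (negP R Q) μ) (+-congˡ (coeff-scale (- 1#) Q μ))
    eigen : ∀ j μ → coeff R (ξ R α j (P List.++ negP R Q)) μ ≈ etaBar R α η j * coeff R (P List.++ negP R Q) μ
    eigen j μ = begin
      coeff R (ξ R α j (P List.++ negP R Q)) μ              ≈⟨ coeff-ξ α j (P List.++ negP R Q) μ ⟩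
      ⟪ P List.++ negP R Q ∣ ξμ ⟫                           ≈⟨ ⟪⟫-++ P (negP R Q) ξμ ⟩
      ⟪ P ∣ ξμ ⟫ + ⟪ negP R Q ∣ ξμ ⟫
        ≈⟨ +-cong (trans (sym (coeff-ξ α j P μ)) (eigenP j μ))
                  (trans (⟪⟫-scale (- 1#) Q ξμ) (*-congˡ (trans (sym (coeff-ξ α j Q μ)) (eigenQ j μ)))) ⟩
      η̄ * coeff R P μ + - 1# * (η̄ * coeff R Q μ)
        ≈⟨ +-congˡ (trans (sym (*-assoc _ _ _)) (trans (*-congʳ (*-comm _ _)) (*-assoc _ _ _))) ⟩
      η̄ * coeff R P μ + η̄ * (- 1# * coeff R Q μ)            ≈⟨ sym (distribˡ _ _ _) ⟩
      η̄ * (coeff R P μ + - 1# * coeff R Q μ)                ≈⟨ *-congˡ (sym (coeff-P-Q μ)) ⟩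
      η̄ * coeff R (P List.++ negP R Q) μ                    ∎
      where
      η̄ = etaBar R α η j
      ξμ : Vec ℕ N → Carrier
      ξμ a = coeff R (ξ R α j (monomial a)) μ

-- Multiplication by x₁⋯x_N

module Shift {c ℓ : Level} (R : CommutativeRing c ℓ) {N : ℕ} where
  open CommutativeRing R renaming (refl to ≈-refl)
  open import Relation.Binary.Reasoning.Setoid setoid
  open Coefficients R
  open Triangularity R {N} using (coeff-var*ddTerms)

  private
    Term : Set c
    Term = Carrier × Vec ℕ N

  xprod* : Poly R N → Poly R N
  xprod* = _*P_ R (xprod R)

  replicate1+≡map-suc : ∀ {n} (e : Vec ℕ n) → Vec.zipWith ℕ._+_ (Vec.replicate n 1) e ≡ Vec.map suc e
  replicate1+≡map-suc [] = refl
  replicate1+≡map-suc (x ∷ e) = cong (suc x ∷_) (replicate1+≡map-suc e)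

  δ₊₁ : Vec ℕ N → Vec ℕ N → Carrier
  δ₊₁ ν b = if Vec.map suc b ==v ν then 1# else 0#

  ⟪⟫-xprod* : ∀ (f : Poly R N) h → ⟪ xprod* f ∣ h ⟫ ≈ ⟪ f ∣ (λ b → h (Vec.map suc b)) ⟫
  ⟪⟫-xprod* f h = trans (mono*-linear 1# (Vec.replicate N 1) f h) (⟪⟫-cong f (λ a →
    trans (+-identityʳ _) (trans (*-congʳ (*-identityˡ 1#)) (trans (*-identityˡ _) (reflexive (cong h (replicate1+≡map-suc a)))))))

  coeff-xprod* : ∀ (f : Poly R N) ν → coeff R (xprod* f) ν ≈ ⟪ f ∣ δ₊₁ ν ⟫
  coeff-xprod* f ν = trans (coeff≈⟪δ⟫ (xprod* f) ν) (⟪⟫-xprod* f (δ ν))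

  coeff-xprod*-suc : ∀ (f : Poly R N) b → coeff R (xprod* f) (Vec.map suc b) ≈ coeff R f b
  coeff-xprod*-suc f b = trans (coeff-xprod* f (Vec.map suc b))
    (trans (⟪⟫-cong f (λ a → reflexive (cong (λ t → if t then 1# else 0#) (==v-map-suc a b)))) (sym (coeff≈⟪δ⟫ f b)))

  coeff-map-cong : ∀ {A : Set} (L : List A) (f g : A → Term) ν → (∀ k → proj₁ (f k) ≈ proj₁ (g k)) →
    (∀ k → proj₂ (f k) ≡ proj₂ (g k)) → coeff R (List.map f L) ν ≈ coeff R (List.map g L) ν
  coeff-map-cong [] f g ν _ _ = ≈-refl
  coeff-map-cong (k ∷ L) f g ν f≈g f≡g rewrite f≡g k = +-cong (if-cong (proj₂ (g k) ==v ν) (f≈g k)) (coeff-map-cong L f g ν f≈g f≡g)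

  unitVec+setAt₂-suc : ∀ (v : Fin N) b i x j y →
    Vec.zipWith ℕ._+_ (unitVec v) (setAt₂ (Vec.map suc b) i (suc x) j (suc y))
      ≡ Vec.zipWith ℕ._+_ (Vec.replicate N 1) (Vec.zipWith ℕ._+_ (unitVec v) (setAt₂ b i x j y))
  unitVec+setAt₂-suc v b i x j y = ≡.trans (lookup-ext _ _ pointwise) (≡.sym (replicate1+≡map-suc _))
    where
    pointwise : ∀ k → lookup (Vec.zipWith ℕ._+_ (unitVec v) (setAt₂ (Vec.map suc b) i (suc x) j (suc y))) k
                    ≡ lookup (Vec.map suc (Vec.zipWith ℕ._+_ (unitVec v) (setAt₂ b i x j y))) k
    pointwise k rewrite lookup-unitVec+setAt₂ v (Vec.map suc b) i (suc x) j (suc y) k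
                      | VecP.lookup-map k suc (Vec.zipWith ℕ._+_ (unitVec v) (setAt₂ b i x j y))
                      | lookup-unitVec+setAt₂ v b i x j y k
      with k ==f i | k ==f j
    ... | true | _ = ℕP.+-suc _ x
    ... | false | true = ℕP.+-suc _ y
    ... | false | false = ≡.trans (cong (_ ℕ.+_) (VecP.lookup-map k suc b)) (ℕP.+-suc _ _)

  var*ddTerms-shift : ∀ (v : Fin N) b i j (r : Carrier) (X Y : ℕ → ℕ) n ν →
    coeff R (_*P_ R (var R v) (scale R 1# (List.map (λ k → (r , setAt₂ (Vec.map suc b) i (suc (X k)) j (suc (Y k)))) (List.upTo n)) List.++ [])) ν
      ≈ coeff R (xprod* (_*P_ R (var R v) (scale R 1# (List.map (λ k → (r , setAt₂ b i (X k) j (Y k))) (List.upTo n)) List.++ []))) ν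
  var*ddTerms-shift v b i j r X Y n ν =
    trans (reflexive (coeff-var*ddTerms v _ n ν))
      (trans (coeff-map-cong (List.upTo n) _ _ ν (λ k → sym (*-identityˡ _)) (λ k → unitVec+setAt₂-suc v b i (X k) j (Y k)))
             (reflexive (cong (λ L → coeff R L ν) (≡.sym (as-map (List.upTo n))))))
    where
    as-map : ∀ ks → xprod* (_*P_ R (var R v) (scale R 1# (List.map (λ k → (r , setAt₂ b i (X k) j (Y k))) ks) List.++ []))
                    ≡ List.map (λ k → (1# * (1# * (1# * r)) , Vec.zipWith ℕ._+_ (Vec.replicate N 1)
                                         (Vec.zipWith ℕ._+_ (unitVec v) (setAt₂ b i (X k) j (Y k))))) ks
    as-map [] = refl
    as-map (k ∷ ks) = cong (_ ∷_) (as-map ks)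

  exchange-shift : ∀ (j i : Fin N) b ν → coeff R (exchange j i (monomial (Vec.map suc b))) ν ≈ coeff R (xprod* (exchange j i (monomial b))) ν
  exchange-shift j i b ν rewrite VecP.lookup-map i suc b | VecP.lookup-map j suc b
    with toℕ i ℕ.<ᵇ toℕ j | toℕ j ℕ.<ᵇ toℕ i | lookup b i ℕ.<ᵇ lookup b j | lookup b j ℕ.<ᵇ lookup b i
  ... | true | _ | true | _ = var*ddTerms-shift j b i j 1# (λ k → q ℕ.+ (p ∸ q ∸ 1 ∸ k)) (q ℕ.+_) (p ∸ q) ν
    where
    p = lookup b j
    q = lookup b i
  ... | true | _ | false | true = var*ddTerms-shift j b i j (- 1#) (p ℕ.+_) (λ k → p ℕ.+ (q ∸ p ∸ 1 ∸ k)) (q ∸ p) ν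
    where
    p = lookup b j
    q = lookup b i
  ... | true | _ | false | false = ≈-refl
  ... | false | true | true | _ = var*ddTerms-shift i b i j 1# (λ k → q ℕ.+ (p ∸ q ∸ 1 ∸ k)) (q ℕ.+_) (p ∸ q) ν
    where
    p = lookup b j
    q = lookup b i
  ... | false | true | false | true = var*ddTerms-shift i b i j (- 1#) (p ℕ.+_) (λ k → p ℕ.+ (q ∸ p ∸ 1 ∸ k)) (q ∸ p) ν
    where
    p = lookup b j
    q = lookup b i
  ... | false | true | false | false = ≈-refl
  ... | false | false | _ | _ = ≈-refl

  exchanges-shift : ∀ (j : Fin N) b ν (L : List (Fin N)) →
    coeff R (List.concat (List.map (λ i → exchange j i (monomial (Vec.map suc b))) L)) ν
      ≈ ⟪ List.concat (List.map (λ i → exchange j i (monomial b)) L) ∣ δ₊₁ ν ⟫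
  exchanges-shift j b ν [] = ≈-refl
  exchanges-shift j b ν (i ∷ L) = trans (coeff-++ (exchange j i (monomial (Vec.map suc b))) _ ν)
    (trans (+-cong (trans (exchange-shift j i b ν) (coeff-xprod* (exchange j i (monomial b)) ν)) (exchanges-shift j b ν L))
           (sym (⟪⟫-++ (exchange j i (monomial b)) _ (δ₊₁ ν))))

  ξ-shift-monomial : ∀ α (j : Fin N) b ν →
    coeff R (ξ R α j (monomial (Vec.map suc b))) ν ≈ coeff R (xprod* (ξ R α j (monomial b))) ν + (if Vec.map suc b ==v ν then α else 0#)
  ξ-shift-monomial α j b ν = begin
      coeff R (euler′ List.++ (exchange′ List.++ constant′)) ν
        ≈⟨ trans (coeff-++ euler′ (exchange′ List.++ constant′) ν) (+-congˡ (coeff-++ exchange′ constant′ ν)) ⟩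
      coeff R euler′ ν + (coeff R exchange′ ν + coeff R constant′ ν)
        ≈⟨ +-cong euler-shift (+-cong (exchanges-shift j b ν (List.allFin N)) constant-shift) ⟩
      (⟪ euler-part ∣ δ₊₁ ν ⟫ + αδ) + (⟪ exchange-part ∣ δ₊₁ ν ⟫ + ⟪ constant-part ∣ δ₊₁ ν ⟫)
        ≈⟨ trans (+-assoc _ _ _) (trans (+-congˡ (+-comm _ _)) (sym (+-assoc _ _ _))) ⟩
      (⟪ euler-part ∣ δ₊₁ ν ⟫ + (⟪ exchange-part ∣ δ₊₁ ν ⟫ + ⟪ constant-part ∣ δ₊₁ ν ⟫)) + αδ
        ≈⟨ +-congʳ (sym (trans (⟪⟫-++ euler-part (exchange-part List.++ constant-part) (δ₊₁ ν))
                                (+-congˡ (⟪⟫-++ exchange-part constant-part (δ₊₁ ν))))) ⟩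
      ⟪ euler-part List.++ (exchange-part List.++ constant-part) ∣ δ₊₁ ν ⟫ + αδ
        ≈⟨ +-congʳ (sym (coeff-xprod* (euler-part List.++ (exchange-part List.++ constant-part)) ν)) ⟩
      coeff R (xprod* (ξ R α j (monomial b))) ν + αδ ∎
    where
    euler′ = scale R α (euler R j (monomial (Vec.map suc b)))
    exchange′ = List.concat (List.map (λ i → exchange j i (monomial (Vec.map suc b))) (List.allFin N))
    constant′ = negP R (scale R (fromℕ R (toℕ j)) (monomial (Vec.map suc b)))
    euler-part = scale R α (euler R j (monomial b))
    exchange-part = List.concat (List.map (λ i → exchange j i (monomial b)) (List.allFin N))
    constant-part = negP R (scale R (fromℕ R (toℕ j)) (monomial b))
    αδ = if Vec.map suc b ==v ν then α else 0#
    constant-shift : coeff R constant′ ν ≈ ⟪ constant-part ∣ δ₊₁ ν ⟫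
    constant-shift = trans (+-identityʳ _) (sym (trans (+-identityʳ _) (sym (if≈*if (Vec.map suc b ==v ν) _))))
    euler-shift : coeff R euler′ ν ≈ ⟪ euler-part ∣ δ₊₁ ν ⟫ + αδ
    euler-shift rewrite VecP.lookup-map j suc b =
      trans (+-identityʳ _) (sym (trans (+-congʳ (trans (+-identityʳ _) (sym (if≈*if (Vec.map suc b ==v ν) _)))) (raise (Vec.map suc b ==v ν))))
      where
      raise : ∀ t → (if t then α * (fromℕ R (lookup b j) * 1#) else 0#) + (if t then α else 0#)
                    ≈ (if t then α * (fromℕ R (suc (lookup b j)) * 1#) else 0#)
      raise true = begin
        α * (fromℕ R (lookup b j) * 1#) + α   ≈⟨ +-cong (*-congˡ (*-identityʳ _)) (sym (*-identityʳ α)) ⟩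
        α * fromℕ R (lookup b j) + α * 1#     ≈⟨ sym (distribˡ α _ _) ⟩
        α * (fromℕ R (lookup b j) + 1#)       ≈⟨ *-congˡ (trans (+-comm _ _) (sym (*-identityʳ _))) ⟩
        α * (fromℕ R (suc (lookup b j)) * 1#) ∎
      raise false = +-identityˡ 0#

  etaBar-map-suc : ∀ α (η : Vec ℕ N) j → etaBar R α (Vec.map suc η) j ≈ etaBar R α η j + α
  etaBar-map-suc α η j = begin
      α * ι (lookup (Vec.map suc η) j) - ι (countBefore (Vec.map suc η) j ℕ.+ countAfter (Vec.map suc η) j)
        ≈⟨ +-cong (*-congˡ (reflexive (cong ι (VecP.lookup-map j suc η))))
                  (-‿cong (reflexive (cong ι (cong₂ ℕ._+_ (countBefore-map-suc η j) (countAfter-map-suc η j))))) ⟩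
      α * (1# + ι (lookup η j)) - ι w         ≈⟨ +-congʳ (trans (distribˡ α 1# _) (trans (+-comm _ _) (+-congˡ (*-identityʳ α)))) ⟩
      (α * ι (lookup η j) + α) + - ι w        ≈⟨ trans (+-assoc _ _ _) (trans (+-congˡ (+-comm _ _)) (sym (+-assoc _ _ _))) ⟩
      (α * ι (lookup η j) - ι w) + α          ∎
    where
    ι = fromℕ R
    w = countBefore η j ℕ.+ countAfter η j

  ξ-xprod* : ∀ α (j : Fin N) (η : Vec ℕ N) (E : Poly R N) → _≈P_ R (ξ R α j E) (scale R (etaBar R α η j) E) →
    ∀ ν → coeff R (ξ R α j (xprod* E)) ν ≈ (etaBar R α η j + α) * coeff R (xprod* E) ν
  ξ-xprod* α j η E eigen ν = begin
      coeff R (ξ R α j (xprod* E)) ν                       ≈⟨ coeff-ξ α j (xprod* E) ν ⟩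
      ⟪ xprod* E ∣ ξν ⟫                                     ≈⟨ ⟪⟫-xprod* E ξν ⟩
      ⟪ E ∣ (λ b → ξν (Vec.map suc b)) ⟫                    ≈⟨ ⟪⟫-cong E (λ b → ξ-shift-monomial α j b ν) ⟩
      ⟪ E ∣ (λ b → coeff R (xprod* (ξ R α j (monomial b))) ν + αδ b) ⟫ ≈⟨ ⟪⟫-+ E _ _ ⟩
      ⟪ E ∣ (λ b → coeff R (xprod* (ξ R α j (monomial b))) ν) ⟫ + ⟪ E ∣ αδ ⟫ ≈⟨ +-cong eigen-part shift-part ⟩
      η̄ * coeff R (xprod* E) ν + α * coeff R (xprod* E) ν  ≈⟨ sym (distribʳ _ _ _) ⟩
      (η̄ + α) * coeff R (xprod* E) ν                       ∎
    where
    η̄ = etaBar R α η j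
    ξν : Vec ℕ N → Carrier
    ξν a = coeff R (ξ R α j (monomial a)) ν
    αδ : Vec ℕ N → Carrier
    αδ b = if Vec.map suc b ==v ν then α else 0#
    eigen-part : ⟪ E ∣ (λ b → coeff R (xprod* (ξ R α j (monomial b))) ν) ⟫ ≈ η̄ * coeff R (xprod* E) ν
    eigen-part = begin
      ⟪ E ∣ (λ b → coeff R (xprod* (ξ R α j (monomial b))) ν) ⟫ ≈⟨ ⟪⟫-cong E (λ b → coeff-xprod* (ξ R α j (monomial b)) ν) ⟩
      ⟪ E ∣ (λ b → ⟪ ξ R α j (monomial b) ∣ δ₊₁ ν ⟫) ⟫         ≈⟨ sym (ξ-linear α j E (δ₊₁ ν)) ⟩
      ⟪ ξ R α j E ∣ δ₊₁ ν ⟫                                   ≈⟨ ⟪⟫-resp-≈P (ξ R α j E) (scale R η̄ E) (δ₊₁ ν) eigen ⟩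
      ⟪ scale R η̄ E ∣ δ₊₁ ν ⟫                                 ≈⟨ ⟪⟫-scale η̄ E (δ₊₁ ν) ⟩
      η̄ * ⟪ E ∣ δ₊₁ ν ⟫                                       ≈⟨ *-congˡ (sym (coeff-xprod* E ν)) ⟩
      η̄ * coeff R (xprod* E) ν                                ∎
    shift-part : ⟪ E ∣ αδ ⟫ ≈ α * coeff R (xprod* E) ν
    shift-part = trans (⟪⟫-cong E (λ b → if≈*if (Vec.map suc b ==v ν) α))
      (trans (⟪⟫-*ˡ E α (δ₊₁ ν)) (*-congˡ (sym (coeff-xprod* E ν))))

  xprod*-NSJack : IsField R → CharZero R → ∀ α → Generic R α → ∀ (η : Vec ℕ N) E E′ →
    IsNSJack R α η E → IsNSJack R α (Vec.map suc η) E′ → _≈P_ R (xprod* E) E′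
  xprod*-NSJack isField charZero α generic η E E′ (Eη≈1 , _ , eigenE) (E′η≈1 , _ , eigenE′) =
    eigenfunctions-agree R isField charZero α generic (Vec.map suc η) (xprod* E) E′
      (trans (coeff-xprod*-suc E η) (trans Eη≈1 (sym E′η≈1)))
      (λ j ν → trans (ξ-xprod* α j η E (eigenE j) ν) (*-congʳ (sym (etaBar-map-suc α η j))))
      (λ j ν → trans (eigenE′ j ν) (coeff-scale (etaBar R α (Vec.map suc η) j) E′ ν))

-- Permutations of the variables

∧-true-l : ∀ {a b} → (a ∧ b) ≡ true → a ≡ true
∧-true-l {true} _ = refl

∧-true-r : ∀ {a b} → (a ∧ b) ≡ true → b ≡ true
∧-true-r {true} e = e

and-map-true : ∀ {A : Set} (f : A → Bool) (xs : List A) → Data.Bool.ListAction.and (List.map f xs) ≡ true →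
  ∀ {x} → x ∈ xs → f x ≡ true
and-map-true f (y ∷ xs) e (here refl) = ∧-true-l e
and-map-true f (y ∷ xs) e (there x∈xs) = and-map-true f xs (∧-true-r {f y} e) x∈xs

isInjective-sound : ∀ {N} (σ : Vec (Fin N) N) → isInjective σ ≡ true → ∀ i j → lookup σ i ≡ lookup σ j → i ≡ j
isInjective-sound {N} σ e i j σi≡σj = ==f-sound i j (distinct (and-map-true test (List.allFin N) row (∈-allFin j)))
  where
  test : Fin N → Bool
  test j = (i ==f j) ∨ not (lookup σ i ==f lookup σ j)
  row = and-map-true (λ i → Data.Bool.ListAction.and (List.map (λ j → (i ==f j) ∨ not (lookup σ i ==f lookup σ j)) (List.allFin N)))
                     (List.allFin N) e (∈-allFin i)
  distinct : test j ≡ true → (i ==f j) ≡ true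
  distinct h rewrite σi≡σj | ==f-refl (lookup σ j) with i ==f j
  ... | true = refl

injective⇒surjective : ∀ {n} (f : Fin n → Fin n) → (∀ i j → f i ≡ f j → i ≡ j) → ∀ k → ∃ λ i → f i ≡ k
injective⇒surjective {suc m} f inj k with FinP.any? (λ i → f i FinP.≟ k)
... | yes hit = hit
... | no miss = ⊥-elim (ℕP.<-irrefl refl (FinP.injective⇒≤ {f = squeeze} squeeze-injective))
  where
  squeeze : Fin (suc m) → Fin m
  squeeze i = Fin.punchOut {i = k} {j = f i} (λ e → miss (i , ≡.sym e))
  squeeze-injective : ∀ {x y} → squeeze x ≡ squeeze y → x ≡ y
  squeeze-injective {x} {y} e = inj x y (FinP.punchOut-injective (λ e → miss (x , ≡.sym e)) (λ e → miss (y , ≡.sym e)) e)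

-- σ is a bijection, so exactly one index i is sent to each k and permExp σ adds one to every entry.
permExp-map-suc : ∀ {N} (σ : Vec (Fin N) N) → isInjective σ ≡ true → ∀ a → permExp σ (Vec.map suc a) ≡ Vec.map suc (permExp σ a)
permExp-map-suc {N} σ inj a = lookup-ext _ _ pointwise
  where
  open import Data.Nat.Base using (_+_)
  σ-injective = isInjective-sound σ inj
  pointwise : ∀ k → lookup (permExp σ (Vec.map suc a)) k ≡ lookup (Vec.map suc (permExp σ a)) k
  pointwise k with injective⇒surjective (lookup σ) σ-injective k
  ... | (i₀ , σi₀≡k) = begin
      lookup (permExp σ (Vec.map suc a)) k
        ≡⟨ VecP.lookup∘tabulate _ k ⟩
      sum (List.map (λ i → if lookup σ i ==f k then lookup (Vec.map suc a) i else 0) (List.allFin N))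
        ≡⟨ sum-map-allFin N _ ⟩
      sumFin N (λ i → if lookup σ i ==f k then lookup (Vec.map suc a) i else 0)
        ≡⟨ sumFin-cong N split ⟩
      sumFin N (λ i → (if lookup σ i ==f k then lookup a i else 0) + 𝟙 (i ==f i₀))
        ≡⟨ sumFin-+ N _ _ ⟩
      sumFin N (λ i → if lookup σ i ==f k then lookup a i else 0) + sumFin N (λ i → 𝟙 (i ==f i₀))
        ≡⟨ cong₂ _+_ (≡.sym (sum-map-allFin N _)) (count-equal N i₀) ⟩
      sum (List.map (λ i → if lookup σ i ==f k then lookup a i else 0) (List.allFin N)) + 1
        ≡⟨ ℕP.+-comm _ 1 ⟩
      suc (sum (List.map (λ i → if lookup σ i ==f k then lookup a i else 0) (List.allFin N)))
        ≡⟨ cong suc (≡.sym (VecP.lookup∘tabulate _ k)) ⟩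
      suc (lookup (permExp σ a) k)
        ≡⟨ ≡.sym (VecP.lookup-map k suc (permExp σ a)) ⟩
      lookup (Vec.map suc (permExp σ a)) k ∎
    where
    open ≡.≡-Reasoning
    sum = Data.Nat.ListAction.sum
    split : ∀ i → (if lookup σ i ==f k then lookup (Vec.map suc a) i else 0) ≡ (if lookup σ i ==f k then lookup a i else 0) + 𝟙 (i ==f i₀)
    split i rewrite VecP.lookup-map i suc a with lookup σ i ==f k in e₁ | i ==f i₀ in e₂
    ... | true | true = ℕP.+-comm 1 _
    ... | false | false = refl
    ... | true | false
      with ≡.trans (≡.sym (==f-refl i)) (cong (i ==f_) (σ-injective i i₀ (≡.trans (==f-sound _ _ e₁) (≡.sym σi₀≡k))))
    ...   | i==i₀ with ≡.trans (≡.sym e₂) (≡.sym i==i₀)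
    ...     | ()
    split i | false | true with ≡.trans (≡.sym e₁) (cong (λ z → lookup σ z ==f k) (==f-sound i i₀ e₂))
    ... | σi₀==k with ≡.trans σi₀==k (≡.trans (cong (_==f k) σi₀≡k) (==f-refl k))
    ...   | ()

module Symmetrisation {c ℓ : Level} (R : CommutativeRing c ℓ) {N : ℕ} where
  open CommutativeRing R renaming (refl to ≈-refl)
  open import Relation.Binary.Reasoning.Setoid setoid
  open Coefficients R
  open Shift R {N}

  Respects≈P : (Poly R N → Poly R N) → Set (c ⊔ ℓ)
  Respects≈P Φ = ∀ f g → _≈P_ R f g → _≈P_ R (Φ f) (Φ g)

  CommutesWithXprod : (Poly R N → Poly R N) → Set (c ⊔ ℓ)
  CommutesWithXprod Φ = ∀ f → _≈P_ R (Φ (xprod* f)) (xprod* (Φ f))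

  ∘-respects : ∀ {Φ Ψ} → Respects≈P Φ → Respects≈P Ψ → Respects≈P (λ f → Ψ (Φ f))
  ∘-respects respΦ respΨ f g f≈g = respΨ _ _ (respΦ f g f≈g)

  ∘-commutes : ∀ {Φ Ψ} → CommutesWithXprod Φ → CommutesWithXprod Ψ → Respects≈P Ψ → CommutesWithXprod (λ f → Ψ (Φ f))
  ∘-commutes {Φ} {Ψ} comΦ comΨ respΨ f ν = trans (respΨ _ _ (comΦ f) ν) (comΨ (Φ f) ν)

  xprod*-respects : Respects≈P xprod*
  xprod*-respects f g f≈g ν = trans (coeff-xprod* f ν) (trans (⟪⟫-resp-≈P f g (δ₊₁ ν) f≈g) (sym (coeff-xprod* g ν)))

  scale-respects : ∀ r → Respects≈P (scale R r)
  scale-respects r f g f≈g ν = trans (coeff-scale r f ν) (trans (*-congˡ (f≈g ν)) (sym (coeff-scale r g ν)))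

  scale-commutes : ∀ r → CommutesWithXprod (scale R r)
  scale-commutes r f ν = begin
    coeff R (scale R r (xprod* f)) ν ≈⟨ coeff-scale r (xprod* f) ν ⟩
    r * coeff R (xprod* f) ν         ≈⟨ *-congˡ (coeff-xprod* f ν) ⟩
    r * ⟪ f ∣ δ₊₁ ν ⟫                 ≈⟨ sym (⟪⟫-scale r f (δ₊₁ ν)) ⟩
    ⟪ scale R r f ∣ δ₊₁ ν ⟫           ≈⟨ sym (coeff-xprod* (scale R r f) ν) ⟩
    coeff R (xprod* (scale R r f)) ν ∎

  ⟪⟫-act : ∀ (σ : Vec (Fin N) N) (f : Poly R N) h → ⟪ act R σ f ∣ h ⟫ ≈ ⟪ f ∣ (λ a → h (permExp σ a)) ⟫
  ⟪⟫-act σ [] h = ≈-refl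
  ⟪⟫-act σ ((r , a) ∷ f) h = +-congˡ (⟪⟫-act σ f h)

  act-respects : ∀ σ → Respects≈P (act R σ)
  act-respects σ f g f≈g ν = trans (coeff≈⟪δ⟫ (act R σ f) ν) (trans (⟪⟫-act σ f (δ ν))
    (trans (⟪⟫-resp-≈P f g _ f≈g) (sym (trans (coeff≈⟪δ⟫ (act R σ g) ν) (⟪⟫-act σ g (δ ν))))))

  act-commutes : ∀ σ → isInjective σ ≡ true → CommutesWithXprod (act R σ)
  act-commutes σ inj f ν = begin
    coeff R (act R σ (xprod* f)) ν                  ≈⟨ trans (coeff≈⟪δ⟫ (act R σ (xprod* f)) ν) (⟪⟫-act σ (xprod* f) (δ ν)) ⟩
    ⟪ xprod* f ∣ (λ a → δ ν (permExp σ a)) ⟫         ≈⟨ ⟪⟫-xprod* f _ ⟩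
    ⟪ f ∣ (λ b → δ ν (permExp σ (Vec.map suc b))) ⟫  ≈⟨ ⟪⟫-cong f (λ b → reflexive (cong (δ ν) (permExp-map-suc σ inj b))) ⟩
    ⟪ f ∣ (λ b → δ₊₁ ν (permExp σ b)) ⟫              ≈⟨ sym (⟪⟫-act σ f (δ₊₁ ν)) ⟩
    ⟪ act R σ f ∣ δ₊₁ ν ⟫                             ≈⟨ sym (coeff-xprod* (act R σ f) ν) ⟩
    coeff R (xprod* (act R σ f)) ν                  ∎

  module _ (K : Fin N → Bool) (Op : Vec (Fin N) N → Poly R N → Poly R N)
           (respects : ∀ σ → Respects≈P (Op σ)) (commutes : ∀ σ → isInjective σ ≡ true → CommutesWithXprod (Op σ)) where

    sumOver : List (Vec (Fin N) N) → Poly R N → Poly R N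
    sumOver L f = List.concat (List.map (λ σ → Op σ f) (filterᵇ (λ σ → isInjective σ ∧ fixesOutside K σ) L))

    sumOver-respects : ∀ L → Respects≈P (sumOver L)
    sumOver-respects [] f g f≈g ν = ≈-refl
    sumOver-respects (σ ∷ L) f g f≈g ν with isInjective σ ∧ fixesOutside K σ
    ... | true = trans (coeff-++ (Op σ f) _ ν) (trans (+-cong (respects σ f g f≈g ν) (sumOver-respects L f g f≈g ν))
                                                      (sym (coeff-++ (Op σ g) _ ν)))
    ... | false = sumOver-respects L f g f≈g ν

    sumOver-commutes : ∀ L → CommutesWithXprod (sumOver L)
    sumOver-commutes [] f ν = ≈-refl
    sumOver-commutes (σ ∷ L) f ν with isInjective σ ∧ fixesOutside K σ in selected
    ... | true = trans (coeff-++ (Op σ (xprod* f)) _ ν)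
      (trans (+-cong (commutes σ (∧-true-l selected) f ν) (sumOver-commutes L f ν)) (sym xprod*-++))
      where
      xprod*-++ : coeff R (xprod* (Op σ f List.++ sumOver L f)) ν ≈ coeff R (xprod* (Op σ f)) ν + coeff R (xprod* (sumOver L f)) ν
      xprod*-++ = trans (coeff-xprod* (Op σ f List.++ sumOver L f) ν) (trans (⟪⟫-++ (Op σ f) (sumOver L f) (δ₊₁ ν))
        (sym (+-cong (coeff-xprod* (Op σ f) ν) (coeff-xprod* (sumOver L f) ν))))
    ... | false = sumOver-commutes L f ν

  signedAct : Vec (Fin N) N → Poly R N → Poly R N
  signedAct σ f = scale R (sgn R σ) (act R σ f)

  signedAct-respects : ∀ σ → Respects≈P (signedAct σ)
  signedAct-respects σ = ∘-respects {act R σ} {scale R (sgn R σ)} (act-respects σ) (scale-respects (sgn R σ))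

  signedAct-commutes : ∀ σ → isInjective σ ≡ true → CommutesWithXprod (signedAct σ)
  signedAct-commutes σ inj =
    ∘-commutes {act R σ} {scale R (sgn R σ)} (act-commutes σ inj) (scale-commutes (sgn R σ)) (scale-respects (sgn R σ))

  Sym-respects : ∀ K → Respects≈P (Sym R K)
  Sym-respects K = sumOver-respects K (act R) act-respects act-commutes (allVecs N N)

  Sym-commutes : ∀ K → CommutesWithXprod (Sym R K)
  Sym-commutes K = sumOver-commutes K (act R) act-respects act-commutes (allVecs N N)

  Asym-respects : ∀ K → Respects≈P (Asym R K)
  Asym-respects K = sumOver-respects K signedAct signedAct-respects signedAct-commutes (allVecs N N)

  Asym-commutes : ∀ K → CommutesWithXprod (Asym R K)
  Asym-commutes K = sumOver-commutes K signedAct signedAct-respects signedAct-commutes (allVecs N N)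

module _ {c ℓ : Level} (R : CommutativeRing c ℓ) {m n : ℕ} where
  open CommutativeRing R using (sym; trans)
  open Shift R {m ℕ.+ n}
  open Symmetrisation R {m ℕ.+ n}

  private
    I J : Fin (m ℕ.+ n) → Bool
    I = inI {m} {n}
    J = inJ {m} {n}

  symOp-respects : ∀ T → Respects≈P (symOp R {m} {n} T)
  symOp-respects AS = ∘-respects {Sym R J} {Asym R I} (Sym-respects J) (Asym-respects I)
  symOp-respects AA = ∘-respects {Asym R J} {Asym R I} (Asym-respects J) (Asym-respects I)
  symOp-respects SA = ∘-respects {Asym R J} {Sym R I} (Asym-respects J) (Sym-respects I)
  symOp-respects SS = ∘-respects {Sym R J} {Sym R I} (Sym-respects J) (Sym-respects I)

  symOp-commutes : ∀ T → CommutesWithXprod (symOp R {m} {n} T)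
  symOp-commutes AS = ∘-commutes {Sym R J} {Asym R I} (Sym-commutes J) (Asym-commutes I) (Asym-respects I)
  symOp-commutes AA = ∘-commutes {Asym R J} {Asym R I} (Asym-commutes J) (Asym-commutes I) (Asym-respects I)
  symOp-commutes SA = ∘-commutes {Asym R J} {Sym R I} (Asym-commutes J) (Sym-commutes I) (Sym-respects I)
  symOp-commutes SS = ∘-commutes {Sym R J} {Sym R I} (Sym-commutes J) (Sym-commutes I) (Sym-respects I)

  etaOf-map-suc : ∀ (A : Vec ℕ m) (B : Vec ℕ n) → etaOf (Vec.map suc A) (Vec.map suc B) ≡ Vec.map suc (etaOf A B)
  etaOf-map-suc A B = ≡.trans (cong₂ Vec._++_ (≡.sym (VecP.map-reverse suc A)) (≡.sym (VecP.map-reverse suc B)))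
                              (≡.sym (VecP.map-++ suc (Vec.reverse A) (Vec.reverse B)))

  symOp-NSJack-shift : IsField R → CharZero R → ∀ α → Generic R α → ∀ T A B E E₊ →
    IsNSJack R α (etaOf A B) E → IsNSJack R α (etaOf (Vec.map suc A) (Vec.map suc B)) E₊ →
    _≈P_ R (symOp R {m} {n} T E₊) (xprod* (symOp R {m} {n} T E))
  symOp-NSJack-shift isField charZero α generic T A B E E₊ E-jack E₊-jack ν =
    trans (symOp-respects T E₊ (xprod* E) (λ μ → sym (xE≈E₊ μ)) ν) (symOp-commutes T E ν)
    where
    xE≈E₊ = xprod*-NSJack isField charZero α generic (etaOf A B) E E₊ E-jack
              (≡.subst (λ η → IsNSJack R α η E₊) (etaOf-map-suc A B) E₊-jack)

open import Data.Nat using (_+_; _≤_)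
open import Data.Vec using (map)

-- Neither m + n ≥ 1 nor the index-set condition on Λ is needed by the argument.
mainTheorem20 : ∀ {c ℓ : Level} (R : CommutativeRing c ℓ) → IsField R → CharZero R →
    (α : CommutativeRing.Carrier R) → Generic R α →
    (m n : ℕ) → 1 ≤ m + n →
    (T : SType) (A : Vec ℕ m) (B : Vec ℕ n) → InIndexSet T A B →
    (P P₊ : Poly R (m + n)) →
    IsSuperJack R α T A B P →
    IsSuperJack R α T (map suc A) (map suc B) P₊ →
    _≈P_ R (_*P_ R (xprod R) P) P₊
mainTheorem20 R isField charZero α generic m n _ T A B _ P P₊
  (E , E-jack , k , P≈kOpE , coeffP≈1) (E₊ , E₊-jack , k₊ , P₊≈k₊OpE₊ , coeffP₊≈1) ν = begin
    coeff R (xprod* P) ν                   ≈⟨ xprod*-respects P (scale R k (Op E)) P≈kOpE ν ⟩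
    coeff R (xprod* (scale R k (Op E))) ν  ≈⟨ sym (scale-commutes k (Op E) ν) ⟩
    coeff R (scale R k (xprod* (Op E))) ν  ≈⟨ scale-respects k (xprod* (Op E)) (Op E₊) (λ μ → sym (shift μ)) ν ⟩
    coeff R (scale R k (Op E₊)) ν          ≈⟨ scale-congˡ (Op E₊) k≈k₊ ν ⟩
    coeff R (scale R k₊ (Op E₊)) ν         ≈⟨ sym (P₊≈k₊OpE₊ ν) ⟩
    coeff R P₊ ν                           ∎
  where
  open CommutativeRing R using (_≈_; _*_; 1#; sym; trans; *-congˡ; setoid)
  open import Relation.Binary.Reasoning.Setoid setoid
  open Coefficients R using (coeff-scale; scale-congˡ; *-inverseˡ-unique)
  open Shift R {m + n} using (xprod*; coeff-xprod*-suc)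
  open Symmetrisation R {m + n} using (xprod*-respects; scale-respects; scale-commutes)
  Op = symOp R {m} {n} T
  shift = symOp-NSJack-shift R isField charZero α generic T A B E E₊ E-jack E₊-jack
  Λ = A Vec.++ B
  -- k and k₊ both invert the coefficient of x^Λ in Op E, which is that of x^(Λ+1) in Op E₊
  k≈k₊ : k ≈ k₊
  k≈k₊ = *-inverseˡ-unique {s = coeff R (Op E) Λ}
    (trans (sym (coeff-scale k (Op E) Λ)) (trans (sym (P≈kOpE Λ)) coeffP≈1))
    (begin
      k₊ * coeff R (Op E) Λ                     ≈⟨ *-congˡ (sym (coeff-xprod*-suc (Op E) Λ)) ⟩
      k₊ * coeff R (xprod* (Op E)) (map suc Λ)  ≈⟨ *-congˡ (sym (shift (map suc Λ))) ⟩
      k₊ * coeff R (Op E₊) (map suc Λ)          ≈⟨ sym (coeff-scale k₊ (Op E₊) (map suc Λ)) ⟩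
      coeff R (scale R k₊ (Op E₊)) (map suc Λ)  ≈⟨ sym (P₊≈k₊OpE₊ (map suc Λ)) ⟩
      coeff R P₊ (map suc Λ)                    ≈⟨ ≡.subst (λ v → coeff R P₊ v ≈ 1#) (≡.sym (VecP.map-++ suc A B)) coeffP₊≈1 ⟩
      1#                                        ∎)
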